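{- Let $n\ge 1$ and $\pi\in\mathcal{NC}_n$. Let $P_\pi:=\kappa(\pi)$ and let $C_{\rho(\pi)}:=\Psi(\rho(\pi))$. Then $P_\pi$ and $C_{\rho(\pi)}$ coincide as words in $\{U,R\}$, where a chord diagram is read as a word by writing $U$ at the left endpoint and $R$ at the right endpoint of each arch, from left to right.
   Context: $\mathcal{NC}_n$ is the set of non-crossing partitions of $[n]$ (no $i<j<k<l$ with $i,k$ in one block and $j,l$ in another block). $\kappa$: order the blocks $B_1,\dots,B_m$ of $\pi$ so that $\min B_1<\dots<\min B_m$. For a block $B$, put $D(B):=U(UR)^{|B|-1}R$. Set $P_1:=D(B_1)$. For $1\le i<m$, let $P_{i+1}$ be obtained from $P_i$ by inserting the word $D(B_{i+1})$ immediately after the $2(\min B_{i+1}-1)$-th letter of $P_i$. Then $\kappa(\pi):=P_m$, a Dyck path of size $n$. Chord diagrams: non-crossing perfect matchings of $2n$ points on a line labelled $1,1',2,2',\dots,n,n'$ from left to right. $\Psi(\pi)$: for each block $\{b_1<\dots<b_p\}$ of $\pi$, take the pairs $(b_k,b_{k+1})$ for $k<p$ and $(b_p,b_1)$ (the pair $(b_1,b_1)$ if $p=1$); for each pair $(i,j)$, draw an arch joining point $i$ to point $(j-1)'$, where $0'=n'$. $\rho$ is the Kreweras endomorphism: place points on a circle in clockwise order $1',1,2',2,\dots,n',n$ ($i'$ between $i-1$ and $i$, and $1'$ between $n$ and $1$). Then $i,j$ lie in the same block of $\rho(\pi)$ if and only if $i',j'$ lie in the same region of the disk cut by the polygons of the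 blocks of $\pi$. -}

module Defs where

open import Data.Bool using (Bool; true; false; _∧_; _∨_; not; if_then_else_)
open import Data.Nat using (ℕ; zero; suc; _+_; _*_; _∸_; _<_; _≤_; _<ᵇ_; _≡ᵇ_; _⊓_; _⊔_)
open import Data.Nat.Properties using (_≟_)
open import Data.List using (List; []; _∷_; _++_; map; concat; concatMap; upTo; splitAt; foldl; replicate; length)
open import Data.Bool.ListAction using (any)
open import Data.List.Membership.Propositional using (_∈_)
open import Data.List.Relation.Unary.All using (All)
open import Data.List.Relation.Unary.Linked using (Linked)
open import Data.List.Relation.Binary.Permutation.Propositional using (_↭_)
open import Data.Product using (_×_; _,_; ∃-syntax)

-- Set partitions of [n] = {1,…,n}, in canonical form:
-- a list of blocks, each block a nonempty strictly increasing list,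
-- the blocks listed in increasing order of their minima, and the blocks
-- together containing every element of [n] exactly once.

Block : Set
Block = List ℕ

Partition : Set
Partition = List Block

range : ℕ → List ℕ
range n = map suc (upTo n)

-- first element (= minimum of a strictly increasing block); 0 on []
minB : Block → ℕ
minB []      = 0
minB (x ∷ _) = x

data NonEmpty {A : Set} : List A → Set where
  nonEmpty : ∀ {x xs} → NonEmpty (x ∷ xs)

record IsPartition (n : ℕ) (π : Partition) : Set where
  field
    blocksNonEmpty   : All NonEmpty π
    blocksIncreasing : All (Linked _<_) π
    minsIncreasing   : Linked _<_ (map minB π)
    coversExactly    : concat π ↭ range n

SameBlock : Partition → ℕ → ℕ → Set
SameBlock π a b = ∃[ B ] (B ∈ π × a ∈ B × b ∈ B)

NonCrossing : Partition → Set
NonCrossing π = ∀ i j k l → i < j → j < k → k < l →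
  SameBlock π i k → SameBlock π j l → SameBlock π i j

data Step : Set where
  U R : Step

Word : Set
Word = List Step

D : Block → Word
D []       = []
D (_ ∷ xs) = U ∷ concat (replicate (length xs) (U ∷ R ∷ [])) ++ R ∷ []

insertAfter : ℕ → Word → Word → Word
insertAfter k w p with splitAt k p
... | (a , b) = a ++ w ++ b

κstep : Word → Block → Word
κstep P B = insertAfter (2 * (minB B ∸ 1)) (D B) P

κ : Partition → Word
κ []       = []
κ (B ∷ Bs) = foldl κstep (D B) Bs

-- Points on the circle clockwise: 1',1,2',2,…,n',n.  For a < b the
-- elements of [n] on the clockwise arc from a' to b' are exactly a,…,b-1.
-- The points a', b' lie in the same region of the disk cut by the block
-- polygons of π iff no block of π has an element on that arc and an
-- element off that arc (a convex polygon separates two boundary points iff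
-- it has vertices on both arcs between them).

inArc : ℕ → ℕ → ℕ → Bool
inArc a b x = (a ≤ᵇ' x) ∧ (x <ᵇ b)
  where
    _≤ᵇ'_ : ℕ → ℕ → Bool
    u ≤ᵇ' v = u <ᵇ suc v

separates : ℕ → ℕ → Block → Bool
separates a b B = any (inArc a b) B ∧ any (λ x → not (inArc a b x)) B

sameRegion : Partition → ℕ → ℕ → Bool
sameRegion π i j = not (any (separates (i ⊓ j) (i ⊔ j)) π)

isMinOfClass : ℕ → Partition → ℕ → Bool
isMinOfClass n π i = not (any (λ j → (j <ᵇ i) ∧ sameRegion π i j) (range n))

filterᵇ : {A : Set} → (A → Bool) → List A → List A
filterᵇ p []       = []
filterᵇ p (x ∷ xs) = if p x then x ∷ filterᵇ p xs else filterᵇ p xs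

ρ : ℕ → Partition → Partition
ρ n π = map (λ i → filterᵇ (sameRegion π i) (range n))
            (filterᵇ (isMinOfClass n π) (range n))

-- Chord diagrams on the 2n points 1,1',2,2',…,n,n' (left to right).

data Point : Set where
  pt  : ℕ → Point
  pt' : ℕ → Point

pos : Point → ℕ
pos (pt i)  = 2 * i ∸ 1
pos (pt' i) = 2 * i

Arch : Set
Arch = Point × Point

ChordDiagram : Set
ChordDiagram = List Arch

cyclicPairs : Block → List (ℕ × ℕ)
cyclicPairs []       = []
cyclicPairs (b ∷ bs) = go b (b ∷ bs)
  where
    go : ℕ → List ℕ → List (ℕ × ℕ)
    go first []            = []
    go first (y ∷ [])      = (y , first) ∷ []
    go first (y ∷ z ∷ zs)  = (y , z) ∷ go first (z ∷ zs)

-- (j-1)' with the convention 0' = n'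
predPrime : ℕ → ℕ → Point
predPrime n zero          = pt' n
predPrime n (suc zero)    = pt' n
predPrime n (suc (suc j)) = pt' (suc j)

Ψ : ℕ → Partition → ChordDiagram
Ψ n π = concatMap (λ B → map (λ { (i , j) → (pt i , predPrime n j) }) (cyclicPairs B)) π

leftPos rightPos : Arch → ℕ
leftPos  (p , q) = pos p ⊓ pos q
rightPos (p , q) = pos p ⊔ pos q

chordWord : ℕ → ChordDiagram → Word
chordWord n C = concatMap atPos (range (2 * n))
  where
    atPos : ℕ → Word
    atPos x = map (λ _ → U) (filterᵇ (λ a → leftPos a ≡ᵇ x) C)
           ++ map (λ _ → R) (filterᵇ (λ a → rightPos a ≡ᵇ x) C)

-- Both words are read two letters per element i of [n], at positions 2i-1 and 2i.
--
-- In κ π the block B is inserted after 2(min B - 1) letters, which are exactly the letters of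
-- 1, …, min B - 1: these lie in earlier blocks, and every other element of an earlier block exceeds
-- max B since blocks do not cross. Inductively κ π therefore writes, for i = 1, …, n, U or R as i
-- is or is not the least element of its block, followed by R or U as i is or is not the largest.
--
-- In Ψ(ρ π) every point i and i' is an end of exactly one arch, so the letter at a point only
-- records whether its arch leaves to the right. The regions cut out by π are described through
-- arcs: i' and k' share a region iff no block of π meets both arcs between them. The arch at i
-- leaves to the right iff i is not the largest element of its region class or the class contains 1,
-- which happens iff i is least in its block of π; the arch at i' leaves to the right iff i + 1 is
-- least in its class, which happens iff i is not the largest element of its block.

{-# OPTIONS --safe #-}
module Submission where

open import Defs
open import Data.Bool using (Bool; true; false; _∧_; _∨_; _xor_; not; if_then_else_)
open import Data.Bool.ListAction using (any; or)
open import Data.Bool.Properties using (T-≡; ∧-identityʳ; ∧-zeroʳ; ∨-zeroʳ; not-involutive; xor-same; xor-comm; if-not)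
open import Data.Empty using (⊥; ⊥-elim)
open import Data.Nat using (ℕ; zero; suc; _+_; _*_; _∸_; _≤_; _<_; _<ᵇ_; _≡ᵇ_; _⊓_; _⊔_; z≤n; s≤s)
open import Data.Nat.Properties
open import Data.List
  using (List; []; _∷_; _++_; [_]; map; concat; concatMap; length; filter; upTo; replicate; splitAt; drop; foldl)
open import Data.List.Properties
  using (length-map; length-applyUpTo; length-++; map-++; map-cong; map-cong-local; map-concatMap; applyUpTo-∷ʳ;
         concatMap-++; concatMap-cong; concat-++; ++-assoc; ++-identityʳ)
open import Data.List.Membership.Propositional using (_∈_; _∉_)
open import Data.List.Membership.Propositional.Properties
  using (∈-map⁺; ∈-map⁻; ∈-upTo⁺; ∈-upTo⁻; ∈-filter⁺; ∈-filter⁻; ∈-++⁺ˡ; ∈-++⁺ʳ; ∈-++⁻; ∈-concat⁺′; ∈-concat⁻′)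
open import Data.List.Membership.DecPropositional _≟_ using (_∈?_)
open import Data.List.Relation.Unary.Any using (here; there)
open import Data.List.Relation.Unary.All as All using (All; []; _∷_)
import Data.List.Relation.Unary.All.Properties as Allₚ
open import Data.List.Relation.Unary.AllPairs using (AllPairs; []; _∷_)
import Data.List.Relation.Unary.AllPairs.Properties as AllPairsₚ
open import Data.List.Relation.Unary.Linked.Properties using (Linked⇒AllPairs)
open import Data.List.Relation.Binary.Permutation.Propositional using (_↭_; ↭-sym)
open import Data.List.Relation.Binary.Permutation.Propositional.Properties using (filter-↭; ↭-length; ∈-resp-↭; ∷↭∷ʳ)
open import Data.Product using (_×_; _,_; proj₁; proj₂; ∃-syntax)
open import Data.Sum using (_⊎_; inj₁; inj₂; [_,_]′)
open import Function using (_∘_)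
open import Function.Bundles using (Equivalence)
open import Relation.Nullary using (yes; no; contradiction)
open import Relation.Nullary.Decidable using (T?; dec-true; dec-false)
open import Relation.Binary.PropositionalEquality hiding ([_])

private variable
  A B C : Set

≡ᵇ-refl : ∀ x → (x ≡ᵇ x) ≡ true
≡ᵇ-refl x = dec-true (x ≟ x) refl

≡ᵇ-false : ∀ {x y} → x ≢ y → (x ≡ᵇ y) ≡ false
≡ᵇ-false {x} {y} = dec-false (x ≟ y)

≡ᵇ-true⁻ : ∀ {x y} → (x ≡ᵇ y) ≡ true → x ≡ y
≡ᵇ-true⁻ {x} {y} e = ≡ᵇ⇒≡ x y (Equivalence.from T-≡ e)

≡-from-true⇔ : ∀ {a b : Bool} → (a ≡ true → b ≡ true) → (b ≡ true → a ≡ true) → a ≡ b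
≡-from-true⇔ {true}  a⇒b _   = sym (a⇒b refl)
≡-from-true⇔ {false} {true} _ b⇒a = b⇒a refl
≡-from-true⇔ {false} {false} _ _ = refl

any-false⁺ : ∀ {p : A → Bool} {xs} → (∀ {x} → x ∈ xs → p x ≡ false) → any p xs ≡ false
any-false⁺ {xs = []}     _    = refl
any-false⁺ {xs = x ∷ xs} none rewrite none (here refl) = any-false⁺ (none ∘ there)

any-true⁺ : ∀ {p : A → Bool} {xs x} → x ∈ xs → p x ≡ true → any p xs ≡ true
any-true⁺ (here refl) px rewrite px = refl
any-true⁺ {p = p} {xs = y ∷ _} (there x∈) px = trans (cong (p y ∨_) (any-true⁺ x∈ px)) (∨-zeroʳ (p y))

any-false⁻ : ∀ {p : A → Bool} {xs x} → any p xs ≡ false → x ∈ xs → p x ≡ false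
any-false⁻ {p = p} {x = x} none x∈ with p x in px
... | false = refl
... | true  = trans (sym (any-true⁺ x∈ px)) none

filterᵇ-filter : (p : A → Bool) → ∀ xs → filterᵇ p xs ≡ filter (T? ∘ p) xs
filterᵇ-filter p [] = refl
filterᵇ-filter p (x ∷ xs) with p x
... | true  = cong (x ∷_) (filterᵇ-filter p xs)
... | false = filterᵇ-filter p xs

∈-filterᵇ⁺ : ∀ (p : A → Bool) {xs x} → x ∈ xs → p x ≡ true → x ∈ filterᵇ p xs
∈-filterᵇ⁺ p {xs} x∈ px = subst (_ ∈_) (sym (filterᵇ-filter p xs)) (∈-filter⁺ (T? ∘ p) x∈ (Equivalence.from T-≡ px))

∈-filterᵇ⁻ : ∀ (p : A → Bool) {xs x} → x ∈ filterᵇ p xs → x ∈ xs × p x ≡ true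
∈-filterᵇ⁻ p {xs} x∈ with ∈-filter⁻ (T? ∘ p) (subst (_ ∈_) (filterᵇ-filter p xs) x∈)
... | x∈xs , px = x∈xs , Equivalence.to T-≡ px

countᵇ : (A → Bool) → List A → ℕ
countᵇ p xs = length (filterᵇ p xs)

countᵇ-++ : ∀ (p : A → Bool) xs ys → countᵇ p (xs ++ ys) ≡ countᵇ p xs + countᵇ p ys
countᵇ-++ p [] ys = refl
countᵇ-++ p (x ∷ xs) ys with p x
... | true  = cong suc (countᵇ-++ p xs ys)
... | false = countᵇ-++ p xs ys

countᵇ-map : ∀ (p : B → Bool) (f : A → B) xs → countᵇ p (map f xs) ≡ countᵇ (p ∘ f) xs
countᵇ-map p f [] = refl
countᵇ-map p f (x ∷ xs) with p (f x)
... | true  = cong suc (countᵇ-map p f xs)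
... | false = countᵇ-map p f xs

countᵇ-cong : ∀ {p q : A → Bool} xs → (∀ {x} → x ∈ xs → p x ≡ q x) → countᵇ p xs ≡ countᵇ q xs
countᵇ-cong [] _ = refl
countᵇ-cong {p = p} {q} (x ∷ xs) p≗q with p x | q x | p≗q (here refl)
... | true  | true  | _ = cong suc (countᵇ-cong xs (p≗q ∘ there))
... | false | false | _ = countᵇ-cong xs (p≗q ∘ there)

countᵇ-↭ : ∀ (p : A → Bool) {xs ys} → xs ↭ ys → countᵇ p xs ≡ countᵇ p ys
countᵇ-↭ p {xs} {ys} xs↭ys = begin
  countᵇ p xs                     ≡⟨ cong length (filterᵇ-filter p xs) ⟩
  length (filter (T? ∘ p) xs)     ≡⟨ ↭-length (filter-↭ (T? ∘ p) xs↭ys) ⟩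
  length (filter (T? ∘ p) ys)     ≡⟨ cong length (filterᵇ-filter p ys) ⟨
  countᵇ p ys                     ∎
  where open ≡-Reasoning

countᵇ-none : ∀ (p : A → Bool) xs → (∀ {x} → x ∈ xs → p x ≡ false) → countᵇ p xs ≡ 0
countᵇ-none p [] _ = refl
countᵇ-none p (x ∷ xs) none rewrite none (here refl) = countᵇ-none p xs (none ∘ there)

countᵇ-∧ʳ : ∀ (p : A → Bool) b xs → countᵇ (λ x → p x ∧ b) xs ≡ (if b then countᵇ p xs else 0)
countᵇ-∧ʳ p true xs = countᵇ-cong xs (λ {x} _ → ∧-identityʳ (p x))
countᵇ-∧ʳ p false xs = countᵇ-none _ xs (λ {x} _ → ∧-zeroʳ (p x))

countᵇ-filterᵇ : ∀ (q p : A → Bool) xs → countᵇ q (filterᵇ p xs) ≡ countᵇ (λ x → q x ∧ p x) xs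
countᵇ-filterᵇ q p [] = refl
countᵇ-filterᵇ q p (x ∷ xs) with p x
... | true  with q x
...   | true  = cong suc (countᵇ-filterᵇ q p xs)
...   | false = countᵇ-filterᵇ q p xs
countᵇ-filterᵇ q p (x ∷ xs) | false with q x
...   | true  = countᵇ-filterᵇ q p xs
...   | false = countᵇ-filterᵇ q p xs

occ : ℕ → List ℕ → ℕ
occ x = countᵇ (_≡ᵇ x)

occ-∉ : ∀ {x} xs → x ∉ xs → occ x xs ≡ 0
occ-∉ {x} xs x∉ = countᵇ-none _ xs (λ {y} y∈ → ≡ᵇ-false {y} {x} (λ { refl → x∉ y∈ }))

occ-∈ : ∀ {x xs} → x ∈ xs → 1 ≤ occ x xs
occ-∈ {x} (here refl) rewrite ≡ᵇ-refl x = s≤s z≤n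
occ-∈ {x} {y ∷ _} (there x∈) with y ≡ᵇ x
... | true  = s≤s z≤n
... | false = occ-∈ x∈

occ-concat-map : ∀ (f : A → List ℕ) (q : A → Bool) {i} xs → (∀ {x} → x ∈ xs → occ i (f x) ≡ (if q x then 1 else 0)) →
  occ i (concat (map f xs)) ≡ countᵇ q xs
occ-concat-map f q [] _ = refl
occ-concat-map f q {i} (x ∷ xs) occ-f = trans (countᵇ-++ _ (f x) (concat (map f xs))) (step (occ-f (here refl)))
  where
  step : occ i (f x) ≡ (if q x then 1 else 0) → occ i (f x) + occ i (concat (map f xs)) ≡ countᵇ q (x ∷ xs)
  step occ-fx with q x
  ... | true  = cong₂ _+_ occ-fx (occ-concat-map f q xs (occ-f ∘ there))
  ... | false = cong₂ _+_ occ-fx (occ-concat-map f q xs (occ-f ∘ there))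

Increasing : List ℕ → Set
Increasing = AllPairs _<_

filterᵇ-increasing : ∀ (p : ℕ → Bool) {xs} → Increasing xs → Increasing (filterᵇ p xs)
filterᵇ-increasing p {xs} inc = subst Increasing (sym (filterᵇ-filter p xs)) (AllPairsₚ.filter⁺ (T? ∘ p) inc)

occ-increasing : ∀ {x xs} → Increasing xs → x ∈ xs → occ x xs ≡ 1
occ-increasing {x} {_ ∷ ys} (x<ys ∷ _) (here refl) rewrite ≡ᵇ-refl x =
  cong suc (occ-∉ ys (λ x∈ → <-irrefl refl (All.lookup x<ys x∈)))
occ-increasing {x} {y ∷ _} (y<ys ∷ inc) (there x∈) rewrite ≡ᵇ-false (<⇒≢ (All.lookup y<ys x∈)) =
  occ-increasing inc x∈

occ-filterᵇ : ∀ (p : ℕ → Bool) {xs i} → Increasing xs → i ∈ xs → occ i (filterᵇ p xs) ≡ (if p i then 1 else 0)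
occ-filterᵇ p {xs} {i} inc i∈ = begin
  occ i (filterᵇ p xs)                        ≡⟨ countᵇ-filterᵇ (_≡ᵇ i) p xs ⟩
  countᵇ (λ y → (y ≡ᵇ i) ∧ p y) xs            ≡⟨ countᵇ-cong xs (λ {y} _ → at-i y) ⟩
  countᵇ (λ y → (y ≡ᵇ i) ∧ p i) xs            ≡⟨ countᵇ-∧ʳ (_≡ᵇ i) (p i) xs ⟩
  (if p i then occ i xs else 0)               ≡⟨ cong (if p i then_else 0) (occ-increasing inc i∈) ⟩
  (if p i then 1 else 0)                      ∎
  where
  open ≡-Reasoning
  at-i : ∀ y → ((y ≡ᵇ i) ∧ p y) ≡ ((y ≡ᵇ i) ∧ p i)
  at-i y with y ≡ᵇ i in y≡ᵇi
  ... | true  = cong p (≡ᵇ-true⁻ y≡ᵇi)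
  ... | false = refl

∈-concat-unique : ∀ {x B C} Q → occ x (concat Q) ≤ 1 → B ∈ Q → C ∈ Q → x ∈ B → x ∈ C → B ≡ C
∈-concat-unique {x} (D ∷ Q) occ≤1 = unique
  where
  occ-split : occ x D + occ x (concat Q) ≤ 1
  occ-split = subst (_≤ 1) (countᵇ-++ _ D (concat Q)) occ≤1
  not-twice : x ∈ D → x ∈ concat Q → ⊥
  not-twice x∈D x∈Q with ≤-trans (+-mono-≤ (occ-∈ x∈D) (occ-∈ x∈Q)) occ-split
  ... | s≤s ()
  unique : ∀ {B C} → B ∈ D ∷ Q → C ∈ D ∷ Q → x ∈ B → x ∈ C → B ≡ C
  unique (here refl) (here refl) _   _   = refl
  unique (here refl) (there C∈)  x∈B x∈C = ⊥-elim (not-twice x∈B (∈-concat⁺′ x∈C C∈))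
  unique (there B∈)  (here refl) x∈B x∈C = ⊥-elim (not-twice x∈C (∈-concat⁺′ x∈B B∈))
  unique (there B∈)  (there C∈)  = ∈-concat-unique Q (≤-trans (m≤n+m _ _) occ-split) B∈ C∈

increasing-≡ : ∀ {xs ys} → Increasing xs → Increasing ys → (∀ {z} → z ∈ xs → z ∈ ys) → (∀ {z} → z ∈ ys → z ∈ xs) → xs ≡ ys
increasing-≡ {[]} {[]} _ _ _ _ = refl
increasing-≡ {[]} {y ∷ _} _ _ _ ys⊆ with () ← ys⊆ (here refl)
increasing-≡ {x ∷ _} {[]} _ _ xs⊆ _ with () ← xs⊆ (here refl)
increasing-≡ {x ∷ xs} {y ∷ ys} (x<xs ∷ inc-xs) (y<ys ∷ inc-ys) xs⊆ ys⊆ =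
  cong₂ _∷_ x≡y (increasing-≡ inc-xs inc-ys (tail xs⊆ x<xs (sym x≡y)) (tail ys⊆ y<ys x≡y))
  where
  head≤ : ∀ {u v vs} → All (v <_) vs → u ∈ v ∷ vs → v ≤ u
  head≤ _ (here refl) = ≤-refl
  head≤ v<vs (there u∈) = <⇒≤ (All.lookup v<vs u∈)
  x≡y : x ≡ y
  x≡y = ≤-antisym (head≤ x<xs (ys⊆ (here refl))) (head≤ y<ys (xs⊆ (here refl)))
  tail : ∀ {u v us vs} → (∀ {z} → z ∈ u ∷ us → z ∈ v ∷ vs) → All (u <_) us → v ≡ u → ∀ {z} → z ∈ us → z ∈ vs
  tail ⊆ u<us v≡u z∈ with ⊆ (there z∈)
  ... | here refl = contradiction (All.lookup u<us z∈) (<-irrefl (sym v≡u))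
  ... | there z∈vs = z∈vs

module _ {R : A → A → Set} where

  AllPairs-before : ∀ xs {y zs x} → AllPairs R (xs ++ y ∷ zs) → x ∈ xs → R x y
  AllPairs-before (_ ∷ xs) (R-x ∷ _)    (here refl) = All.lookup R-x (∈-++⁺ʳ xs (here refl))
  AllPairs-before (_ ∷ xs) (_ ∷ pairs) (there x∈)  = AllPairs-before xs pairs x∈

  AllPairs-after : ∀ xs {y zs z} → AllPairs R (xs ++ y ∷ zs) → z ∈ zs → R y z
  AllPairs-after []       (R-y ∷ _)    z∈ = All.lookup R-y z∈
  AllPairs-after (_ ∷ xs) (_ ∷ pairs) z∈ = AllPairs-after xs pairs z∈

  AllPairs-++⁻ : ∀ xs {ys} → AllPairs R (xs ++ ys) → AllPairs R xs × AllPairs R ys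
  AllPairs-++⁻ []       pairs         = [] , pairs
  AllPairs-++⁻ (x ∷ xs) (R-x ∷ pairs) = Allₚ.++⁻ˡ xs R-x ∷ proj₁ (AllPairs-++⁻ xs pairs) , proj₂ (AllPairs-++⁻ xs pairs)

lastB : Block → ℕ
lastB []           = 0
lastB (x ∷ [])     = x
lastB (_ ∷ y ∷ ys) = lastB (y ∷ ys)

lastB∈ : ∀ x xs → lastB (x ∷ xs) ∈ x ∷ xs
lastB∈ x []       = here refl
lastB∈ x (y ∷ ys) = there (lastB∈ y ys)

minB≤ : ∀ {B x} → Increasing B → x ∈ B → minB B ≤ x
minB≤ _           (here refl) = ≤-refl
minB≤ (b<bs ∷ _) (there x∈)  = <⇒≤ (All.lookup b<bs x∈)

≤lastB : ∀ {x B} → Increasing B → x ∈ B → x ≤ lastB B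
≤lastB {B = _ ∷ []}     _                 (here refl) = ≤-refl
≤lastB {B = _ ∷ _ ∷ _} (b<bs ∷ inc) (here refl) = <⇒≤ (<-≤-trans (All.lookup b<bs (here refl)) (≤lastB inc (here refl)))
≤lastB {B = _ ∷ _ ∷ _} (_ ∷ inc)    (there x∈)  = ≤lastB inc x∈

increasing-split : ∀ {K b} → Increasing K → b ∉ K →
  ∃[ lo ] ∃[ hi ] (K ≡ lo ++ hi × All (_< b) lo × All (b <_) hi)
increasing-split {[]} _ _ = [] , [] , refl , [] , []
increasing-split {y ∷ ys} {b} (y<ys ∷ inc) b∉ with y <? b
... | yes y<b =
  let lo , hi , ys≡ , lo<b , b<hi = increasing-split inc (b∉ ∘ there)
  in y ∷ lo , hi , cong (y ∷_) ys≡ , y<b ∷ lo<b , b<hi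
... | no y≮b = [] , y ∷ ys , refl , [] , b<y ∷ All.map (<-trans b<y) y<ys
  where
  b<y : b < y
  b<y = ≤∧≢⇒< (≮⇒≥ y≮b) (b∉ ∘ here)

∈-range⁺ : ∀ {n x} → 1 ≤ x → x ≤ n → x ∈ range n
∈-range⁺ {x = suc x} _ x<n = ∈-map⁺ suc (∈-upTo⁺ x<n)

∈-range⁻ : ∀ {n x} → x ∈ range n → 1 ≤ x × x ≤ n
∈-range⁻ x∈ with ∈-map⁻ suc x∈
... | _ , y∈ , refl = s≤s z≤n , ∈-upTo⁻ y∈

range-increasing : ∀ n → Increasing (range n)
range-increasing n = AllPairsₚ.map⁺ (AllPairsₚ.applyUpTo⁺₁ _ n (λ i<j _ → s≤s i<j))

length-range : ∀ n → length (range n) ≡ n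
length-range n = trans (length-map suc (upTo n)) (length-applyUpTo _ n)

range-suc : ∀ n → range (suc n) ≡ range n ++ [ suc n ]
range-suc n = trans (cong (map suc) (sym (applyUpTo-∷ʳ _ n))) (map-++ suc (upTo n) [ n ])

range-double : ∀ n → range (2 * n) ≡ concatMap (λ i → 2 * i ∸ 1 ∷ 2 * i ∷ []) (range n)
range-double zero = refl
range-double (suc n) = begin
  range (2 * suc n)                                            ≡⟨ cong range 2[1+n]≡ ⟩
  range (suc (suc (2 * n)))                                    ≡⟨ range-suc (suc (2 * n)) ⟩
  range (suc (2 * n)) ++ [ suc (suc (2 * n)) ]                 ≡⟨ cong (_++ [ suc (suc (2 * n)) ]) (range-suc (2 * n)) ⟩
  (range (2 * n) ++ [ suc (2 * n) ]) ++ [ suc (suc (2 * n)) ]  ≡⟨ ++-assoc (range (2 * n)) _ _ ⟩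
  range (2 * n) ++ suc (2 * n) ∷ suc (suc (2 * n)) ∷ []        ≡⟨ cong (range (2 * n) ++_) pair≡ ⟨
  range (2 * n) ++ pair (suc n)                                ≡⟨ cong (_++ pair (suc n)) (range-double n) ⟩
  concatMap pair (range n) ++ pair (suc n)                     ≡⟨ concatMap-++ pair (range n) [ suc n ] ⟨
  concatMap pair (range n ++ [ suc n ])                        ≡⟨ cong (concatMap pair) (range-suc n) ⟨
  concatMap pair (range (suc n))                               ∎
  where
  open ≡-Reasoning
  pair : ℕ → List ℕ
  pair i = 2 * i ∸ 1 ∷ 2 * i ∷ []
  2[1+n]≡ : 2 * suc n ≡ suc (suc (2 * n))
  2[1+n]≡ = *-suc 2 n
  pair≡ : pair (suc n) ≡ suc (2 * n) ∷ suc (suc (2 * n)) ∷ []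
  pair≡ = cong₂ (λ a b → a ∷ b ∷ []) (cong (_∸ 1) 2[1+n]≡) 2[1+n]≡

splitAt-++ : ∀ (xs ys : List A) → splitAt (length xs) (xs ++ ys) ≡ (xs , ys)
splitAt-++ []       ys = refl
splitAt-++ (x ∷ xs) ys rewrite splitAt-++ xs ys = refl

insertAfter-++ : ∀ (w xs ys : Word) → insertAfter (length xs) w (xs ++ ys) ≡ xs ++ w ++ ys
insertAfter-++ w xs ys with splitAt (length xs) (xs ++ ys) | splitAt-++ xs ys
... | _ | refl = refl

length-concatMap-pairs : ∀ (f : A → List B) xs → (∀ x → length (f x) ≡ 2) → length (concatMap f xs) ≡ 2 * length xs
length-concatMap-pairs f []       _       = refl
length-concatMap-pairs f (x ∷ xs) length2 = begin
  length (f x ++ concatMap f xs)          ≡⟨ length-++ (f x) ⟩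
  length (f x) + length (concatMap f xs)  ≡⟨ cong₂ _+_ (length2 x) (length-concatMap-pairs f xs length2) ⟩
  2 + 2 * length xs                       ≡⟨ *-suc 2 (length xs) ⟨
  2 * length (x ∷ xs)                     ∎
  where open ≡-Reasoning

map-const : ∀ (c : B) (xs : List A) → map (λ _ → c) xs ≡ replicate (length xs) c
map-const c []       = refl
map-const c (x ∷ xs) = cong (c ∷_) (map-const c xs)

concatMap-concatMap : ∀ (f : B → List C) (g : A → List B) xs →
  concatMap f (concatMap g xs) ≡ concatMap (concatMap f ∘ g) xs
concatMap-concatMap f g []       = refl
concatMap-concatMap f g (x ∷ xs) =
  trans (concatMap-++ f (g x) (concatMap g xs)) (cong (concatMap f (g x) ++_) (concatMap-concatMap f g xs))

-- Arcs and regions of the disk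

Constant : (ℕ → Bool) → Block → Set
Constant f B = ∀ {x y} → x ∈ B → y ∈ B → f x ≡ f y

¬separated⇒constant : ∀ f B → (any f B ∧ any (not ∘ f) B) ≡ false → Constant f B
¬separated⇒constant f B ¬sep {x} {y} x∈ y∈ with f x in fx | f y in fy
... | true  | true  = refl
... | false | false = refl
... | true  | false rewrite any-true⁺ {p = f} x∈ fx | any-true⁺ {p = not ∘ f} y∈ (cong not fy) with () ← ¬sep
... | false | true  rewrite any-true⁺ {p = f} y∈ fy | any-true⁺ {p = not ∘ f} x∈ (cong not fx) with () ← ¬sep

constant⇒¬separated : ∀ f B → Constant f B → (any f B ∧ any (not ∘ f) B) ≡ false
constant⇒¬separated f []      _     = refl
constant⇒¬separated f (b ∷ _) const with f b in fb
... | true  = any-false⁺ {p = not ∘ f} (λ x∈ → cong not (trans (const (there x∈) (here refl)) fb))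
... | false = cong (_∧ _) (any-false⁺ {p = f} (λ x∈ → trans (const (there x∈) (here refl)) fb))

≤ᵇ-true : ∀ {i x} → i ≤ x → (i <ᵇ suc x) ≡ true
≤ᵇ-true {i} {x} i≤x = dec-true (i <? suc x) (s≤s i≤x)

≤ᵇ-false : ∀ {i x} → x < i → (i <ᵇ suc x) ≡ false
≤ᵇ-false {i} {x} x<i = dec-false (i <? suc x) (<⇒≱ x<i ∘ ≤-pred)

<ᵇ-true : ∀ {x k} → x < k → (x <ᵇ k) ≡ true
<ᵇ-true {x} {k} = dec-true (x <? k)

<ᵇ-false : ∀ {x k} → k ≤ x → (x <ᵇ k) ≡ false
<ᵇ-false {x} {k} k≤x = dec-false (x <? k) (≤⇒≯ k≤x)

-- x lies on the arc from (i ⊓ k)' clockwise to (i ⊔ k)', which carries i ⊓ k, …, i ⊔ k ∸ 1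
onArc : ℕ → ℕ → ℕ → Bool
onArc i k x = (i <ᵇ suc x) xor (k <ᵇ suc x)

onArc-inside : ∀ {i k x} → i ≤ x → x < k → onArc i k x ≡ true
onArc-inside i≤x x<k rewrite ≤ᵇ-true i≤x | ≤ᵇ-false x<k = refl

onArc-below : ∀ {i k x} → x < i → i ≤ k → onArc i k x ≡ false
onArc-below x<i i≤k rewrite ≤ᵇ-false x<i | ≤ᵇ-false (<-≤-trans x<i i≤k) = refl

onArc-above : ∀ {i k x} → k ≤ x → i ≤ k → onArc i k x ≡ false
onArc-above k≤x i≤k rewrite ≤ᵇ-true (≤-trans i≤k k≤x) | ≤ᵇ-true k≤x = refl

onArc-true⁻ : ∀ {i k x} → i ≤ k → onArc i k x ≡ true → i ≤ x × x < k
onArc-true⁻ {i} {k} {x} i≤k on with x <? i | x <? k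
... | yes x<i | _       rewrite onArc-below x<i i≤k with () ← on
... | no  x≮i | yes x<k = ≮⇒≥ x≮i , x<k
... | no  _   | no  x≮k rewrite onArc-above (≮⇒≥ x≮k) i≤k with () ← on

inArc-onArc : ∀ {i k} x → i ≤ k → inArc i k x ≡ onArc i k x
inArc-onArc {i} {k} x i≤k with x <? i | x <? k
... | yes x<i | _       rewrite ≤ᵇ-false x<i | ≤ᵇ-false (<-≤-trans x<i i≤k) = refl
... | no  x≮i | yes x<k rewrite ≤ᵇ-true (≮⇒≥ x≮i) | <ᵇ-true x<k | ≤ᵇ-false x<k = refl
... | no  x≮i | no  x≮k rewrite ≤ᵇ-true (≮⇒≥ x≮i) | <ᵇ-false (≮⇒≥ x≮k) | ≤ᵇ-true (≮⇒≥ x≮k) = refl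

onArc-sym : ∀ i k x → onArc i k x ≡ onArc k i x
onArc-sym i k x = xor-comm (i <ᵇ suc x) (k <ᵇ suc x)

onArc-trans : ∀ i j k x → onArc i k x ≡ onArc i j x xor onArc j k x
onArc-trans i j k x with i <ᵇ suc x | j <ᵇ suc x | k <ᵇ suc x
... | true  | true  | c = refl
... | true  | false | true  = refl
... | true  | false | false = refl
... | false | true  | true  = refl
... | false | true  | false = refl
... | false | false | c = refl

inArc-⊓⊔ : ∀ i k x → inArc (i ⊓ k) (i ⊔ k) x ≡ onArc i k x
inArc-⊓⊔ i k x with ≤-total i k
... | inj₁ i≤k rewrite m≤n⇒m⊓n≡m i≤k | m≤n⇒m⊔n≡n i≤k = inArc-onArc x i≤k
... | inj₂ k≤i rewrite m≥n⇒m⊓n≡n k≤i | m≥n⇒m⊔n≡m k≤i = trans (inArc-onArc x k≤i) (onArc-sym k i x)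

record SameRegion (π : Partition) (i k : ℕ) : Set where
  constructor sameRegion⁺
  field
    sameSide : ∀ {B} → B ∈ π → Constant (onArc i k) B

open SameRegion public

separates-⊓⊔ : ∀ i k B → separates (i ⊓ k) (i ⊔ k) B ≡ (any (onArc i k) B ∧ any (not ∘ onArc i k) B)
separates-⊓⊔ i k B =
  cong₂ _∧_ (cong or (map-cong (inArc-⊓⊔ i k) B)) (cong or (map-cong (cong not ∘ inArc-⊓⊔ i k) B))

sameRegion⇒SameRegion : ∀ {π i k} → sameRegion π i k ≡ true → SameRegion π i k
sameRegion⇒SameRegion {π} {i} {k} same = sameRegion⁺ λ {B} B∈ →
  ¬separated⇒constant (onArc i k) B (trans (sym (separates-⊓⊔ i k B)) (any-false⁻ noSeparator B∈))
  where
  noSeparator : any (separates (i ⊓ k) (i ⊔ k)) π ≡ false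
  noSeparator = trans (sym (not-involutive _)) (cong not same)

SameRegion⇒sameRegion : ∀ {π i k} → SameRegion π i k → sameRegion π i k ≡ true
SameRegion⇒sameRegion {π} {i} {k} same = cong not (any-false⁺ λ {B} B∈ →
  trans (separates-⊓⊔ i k B) (constant⇒¬separated (onArc i k) B (sameSide same B∈)))

module _ {π : Partition} where

  SameRegion-refl : ∀ i → SameRegion π i i
  SameRegion-refl i = sameRegion⁺ λ _ {x} {y} _ _ → trans (xor-same (i <ᵇ suc x)) (sym (xor-same (i <ᵇ suc y)))

  SameRegion-sym : ∀ {i k} → SameRegion π i k → SameRegion π k i
  SameRegion-sym {i} {k} same = sameRegion⁺ λ B∈ {x} {y} x∈ y∈ →
    trans (onArc-sym k i x) (trans (sameSide same B∈ x∈ y∈) (onArc-sym i k y))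

  SameRegion-trans : ∀ {i j k} → SameRegion π i j → SameRegion π j k → SameRegion π i k
  SameRegion-trans {i} {j} {k} sameᵢⱼ sameⱼₖ = sameRegion⁺ λ B∈ {x} {y} x∈ y∈ → begin
    onArc i k x                      ≡⟨ onArc-trans i j k x ⟩
    onArc i j x xor onArc j k x      ≡⟨ cong₂ _xor_ (sameSide sameᵢⱼ B∈ x∈ y∈) (sameSide sameⱼₖ B∈ x∈ y∈) ⟩
    onArc i j y xor onArc j k y      ≡⟨ onArc-trans i j k y ⟨
    onArc i k y                      ∎
    where open ≡-Reasoning

  SameRegion-confines : ∀ {i k B x y} → i ≤ k → SameRegion π i k → B ∈ π → x ∈ B → y ∈ B →
    i ≤ x → x < k → i ≤ y × y < k
  SameRegion-confines i≤k same B∈ x∈ y∈ i≤x x<k =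
    onArc-true⁻ i≤k (trans (sym (sameSide same B∈ x∈ y∈)) (onArc-inside i≤x x<k))

module _ {π : Partition} where

  sameRegion-refl : ∀ x → sameRegion π x x ≡ true
  sameRegion-refl x = SameRegion⇒sameRegion {π} (SameRegion-refl x)

  sameRegion-sym : ∀ x y → sameRegion π x y ≡ true → sameRegion π y x ≡ true
  sameRegion-sym x y x~y = SameRegion⇒sameRegion {π} (SameRegion-sym (sameRegion⇒SameRegion {π} {x} {y} x~y))

  sameRegion-trans : ∀ x y z → sameRegion π x y ≡ true → sameRegion π y z ≡ true → sameRegion π x z ≡ true
  sameRegion-trans x y z x~y y~z = SameRegion⇒sameRegion {π}
    (SameRegion-trans (sameRegion⇒SameRegion {π} {x} {y} x~y) (sameRegion⇒SameRegion {π} {y} {z} y~z))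

-- ρ n π is `classes` for r = sameRegion π and L = range n.
module Classes (r : ℕ → ℕ → Bool) (L : List ℕ) (L-increasing : Increasing L)
  (r-refl : ∀ x → r x x ≡ true)
  (r-sym : ∀ x y → r x y ≡ true → r y x ≡ true)
  (r-trans : ∀ x y z → r x y ≡ true → r y z ≡ true → r x z ≡ true) where

  isLeast : ℕ → Bool
  isLeast i = not (any (λ j → (j <ᵇ i) ∧ r i j) L)

  class : ℕ → List ℕ
  class i = filterᵇ (r i) L

  classes : List (List ℕ)
  classes = map class (filterᵇ isLeast L)

  ∈-class⁺ : ∀ m {t} → t ∈ L → r m t ≡ true → t ∈ class m
  ∈-class⁺ m t∈ rmt = ∈-filterᵇ⁺ (r m) t∈ rmt

  ∈-class⁻ : ∀ m {t} → t ∈ class m → t ∈ L × r m t ≡ true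
  ∈-class⁻ m = ∈-filterᵇ⁻ (r m)

  isLeast-true⁻ : ∀ {m j} → isLeast m ≡ true → j ∈ L → j < m → r m j ≡ false
  isLeast-true⁻ {m} {j} least j∈ j<m with r m j in rmj
  ... | false = refl
  ... | true  = contradiction (trans (sym least) (cong not (any-true⁺ {p = λ j → (j <ᵇ m) ∧ r m j} j∈ below))) λ ()
    where
    below : ((j <ᵇ m) ∧ r m j) ≡ true
    below rewrite dec-true (j <? m) j<m | rmj = refl

  isLeast-true⁺ : ∀ {m} → (∀ {j} → j ∈ L → j < m → r m j ≡ false) → isLeast m ≡ true
  isLeast-true⁺ {m} noneBelow = cong not (any-false⁺ λ {j} j∈ → below j j∈)
    where
    below : ∀ j → j ∈ L → ((j <ᵇ m) ∧ r m j) ≡ false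
    below j j∈ with j <? m
    ... | yes j<m rewrite dec-true (j <? m) j<m = noneBelow j∈ j<m
    ... | no  j≮m rewrite dec-false (j <? m) j≮m = refl

  module _ {i} (i∈ : i ∈ L) where

    least : ℕ
    least = minB (class i)

    i∈class : i ∈ class i
    i∈class = ∈-class⁺ i i∈ (r-refl i)

    least∈class : least ∈ class i
    least∈class with class i | i∈class
    ... | _ ∷ _ | _ = here refl

    least≤ : ∀ {t} → t ∈ class i → least ≤ t
    least≤ = minB≤ (filterᵇ-increasing (r i) L-increasing)

    least-isLeast : isLeast least ≡ true
    least-isLeast = isLeast-true⁺ λ {j} j∈ j<least → noneBelow j∈ j<least
      where
      noneBelow : ∀ {j} → j ∈ L → j < least → r least j ≡ false
      noneBelow {j} j∈ j<least with r least j in rlj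
      ... | false = refl
      ... | true  = contradiction (least≤ (∈-class⁺ i j∈ (r-trans _ _ _ (proj₂ (∈-class⁻ i least∈class)) rlj))) (<⇒≱ j<least)

    index-of-class-of-i : ∀ {m} → m ∈ L → (r m i ∧ isLeast m) ≡ (m ≡ᵇ least)
    index-of-class-of-i {m} m∈ = ≡-from-true⇔ indexes⇒least least⇒indexes
      where
      r-i-least : r i least ≡ true
      r-i-least = proj₂ (∈-class⁻ i least∈class)
      indexes⇒least : (r m i ∧ isLeast m) ≡ true → (m ≡ᵇ least) ≡ true
      indexes⇒least rmi∧least with r m i in rmi | isLeast m in leastₘ
      ... | true | true with least <? m
      ...   | yes least<m with () ← trans (sym (isLeast-true⁻ leastₘ (proj₁ (∈-class⁻ i least∈class)) least<m))
                                          (r-trans _ _ _ rmi r-i-least)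
      ...   | no  least≮m = subst (λ t → (m ≡ᵇ t) ≡ true)
                  (≤-antisym (≮⇒≥ least≮m) (least≤ (∈-class⁺ i m∈ (r-sym _ _ rmi)))) (≡ᵇ-refl m)
      least⇒indexes : (m ≡ᵇ least) ≡ true → (r m i ∧ isLeast m) ≡ true
      least⇒indexes m≡ᵇleast = subst (λ t → (r t i ∧ isLeast t) ≡ true) (sym (≡ᵇ-true⁻ m≡ᵇleast))
                                 (cong₂ _∧_ (r-sym _ _ r-i-least) least-isLeast)

  occ-classes : ∀ {i} → i ∈ L → occ i (concat classes) ≡ 1
  occ-classes {i} i∈ = begin
    occ i (concat classes)                              ≡⟨ occ-concat-map class (λ m → r m i) _ occ-class ⟩
    countᵇ (λ m → r m i) (filterᵇ isLeast L)            ≡⟨ countᵇ-filterᵇ _ isLeast L ⟩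
    countᵇ (λ m → r m i ∧ isLeast m) L                  ≡⟨ countᵇ-cong L (index-of-class-of-i i∈) ⟩
    occ (least i∈) L
      ≡⟨ occ-increasing L-increasing (proj₁ (∈-class⁻ i (least∈class i∈))) ⟩
    1                                                   ∎
    where
    open ≡-Reasoning
    occ-class : ∀ {m} → m ∈ filterᵇ isLeast L → occ i (class m) ≡ (if r m i then 1 else 0)
    occ-class _ = occ-filterᵇ (r _) L-increasing i∈

  ∈-classes⁻ : ∀ {C} → C ∈ classes → ∃[ m ] C ≡ class m
  ∈-classes⁻ C∈ with ∈-map⁻ class C∈
  ... | m , _ , C≡ = m , C≡

cyclicChain : ℕ → List ℕ → List (ℕ × ℕ)
cyclicChain first []           = []
cyclicChain first (y ∷ [])     = (y , first) ∷ []
cyclicChain first (y ∷ z ∷ zs) = (y , z) ∷ cyclicChain first (z ∷ zs)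

cyclicPairs-chain : ∀ b bs → cyclicPairs (b ∷ bs) ≡ cyclicChain b (b ∷ bs)
cyclicPairs-chain b []       = refl
cyclicPairs-chain b (c ∷ cs) = cong ((b , c) ∷_) (tail-chain c cs)
  where
  -- the where-bound helper of cyclicPairs is reached as the tail of cyclicPairs (b ∷ c ∷ cs)
  tail-chain : ∀ c cs → drop 1 (cyclicPairs (b ∷ c ∷ cs)) ≡ cyclicChain b (c ∷ cs)
  tail-chain c []       = refl
  tail-chain c (d ∷ ds) = cong ((c , d) ∷_) (tail-chain d ds)

map-proj₁-chain : ∀ f y ys → map proj₁ (cyclicChain f (y ∷ ys)) ≡ y ∷ ys
map-proj₁-chain f y []       = refl
map-proj₁-chain f y (z ∷ zs) = cong (y ∷_) (map-proj₁-chain f z zs)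

map-proj₂-chain : ∀ f y ys → map proj₂ (cyclicChain f (y ∷ ys)) ≡ ys ++ [ f ]
map-proj₂-chain f y []       = refl
map-proj₂-chain f y (z ∷ zs) = cong (z ∷_) (map-proj₂-chain f z zs)

map-proj₁-cyclicPairs : ∀ L → map proj₁ (cyclicPairs L) ≡ L
map-proj₁-cyclicPairs []       = refl
map-proj₁-cyclicPairs (b ∷ bs) = trans (cong (map proj₁) (cyclicPairs-chain b bs)) (map-proj₁-chain b b bs)

occ-proj₂-cyclicPairs : ∀ i L → occ i (map proj₂ (cyclicPairs L)) ≡ occ i L
occ-proj₂-cyclicPairs i []       = refl
occ-proj₂-cyclicPairs i (b ∷ bs) = begin
  occ i (map proj₂ (cyclicPairs (b ∷ bs)))  ≡⟨ cong (occ i ∘ map proj₂) (cyclicPairs-chain b bs) ⟩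
  occ i (map proj₂ (cyclicChain b (b ∷ bs))) ≡⟨ cong (occ i) (map-proj₂-chain b b bs) ⟩
  occ i (bs ++ [ b ])                        ≡⟨ countᵇ-↭ _ (∷↭∷ʳ b bs) ⟨
  occ i (b ∷ bs)                             ∎
  where open ≡-Reasoning

∈-chain⁻ : ∀ {a j} f y ys → Increasing (y ∷ ys) → (a , j) ∈ cyclicChain f (y ∷ ys) →
  (a < j × a ∈ y ∷ ys × j ∈ y ∷ ys) ⊎ (a ≡ lastB (y ∷ ys) × j ≡ f)
∈-chain⁻ f y []       _                (here refl) = inj₂ (refl , refl)
∈-chain⁻ f y (z ∷ zs) (y<z∷zs ∷ _)     (here refl) = inj₁ (All.lookup y<z∷zs (here refl) , here refl , there (here refl))
∈-chain⁻ f y (z ∷ zs) (_ ∷ increasing) (there p∈) with ∈-chain⁻ f z zs increasing p∈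
... | inj₁ (a<j , a∈ , j∈) = inj₁ (a<j , there a∈ , there j∈)
... | inj₂ wrap            = inj₂ wrap

∈-cyclicPairs⁻ : ∀ {a j} b bs → Increasing (b ∷ bs) → (a , j) ∈ cyclicPairs (b ∷ bs) →
  (a < j × a ∈ b ∷ bs × j ∈ b ∷ bs) ⊎ (a ≡ lastB (b ∷ bs) × j ≡ b)
∈-cyclicPairs⁻ b bs increasing p∈ = ∈-chain⁻ b b bs increasing (subst (_ ∈_) (cyclicPairs-chain b bs) p∈)

map-proj₁-concatMap-cyclicPairs : ∀ X → map proj₁ (concatMap cyclicPairs X) ≡ concat X
map-proj₁-concatMap-cyclicPairs []      = refl
map-proj₁-concatMap-cyclicPairs (L ∷ X) = trans (map-++ proj₁ (cyclicPairs L) (concatMap cyclicPairs X))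
  (cong₂ _++_ (map-proj₁-cyclicPairs L) (map-proj₁-concatMap-cyclicPairs X))

occ-proj₂-concatMap-cyclicPairs : ∀ i X → occ i (map proj₂ (concatMap cyclicPairs X)) ≡ occ i (concat X)
occ-proj₂-concatMap-cyclicPairs i []      = refl
occ-proj₂-concatMap-cyclicPairs i (L ∷ X) = begin
  occ i (map proj₂ (cyclicPairs L ++ concatMap cyclicPairs X))
    ≡⟨ cong (occ i) (map-++ proj₂ (cyclicPairs L) (concatMap cyclicPairs X)) ⟩
  occ i (map proj₂ (cyclicPairs L) ++ map proj₂ (concatMap cyclicPairs X))
    ≡⟨ countᵇ-++ _ (map proj₂ (cyclicPairs L)) _ ⟩
  occ i (map proj₂ (cyclicPairs L)) + occ i (map proj₂ (concatMap cyclicPairs X))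
    ≡⟨ cong₂ _+_ (occ-proj₂-cyclicPairs i L) (occ-proj₂-concatMap-cyclicPairs i X) ⟩
  occ i L + occ i (concat X)
    ≡⟨ countᵇ-++ _ L (concat X) ⟨
  occ i (concat (L ∷ X))
    ∎
  where open ≡-Reasoning

-- Blocks of a non-crossing partition

blockOf : Partition → ℕ → Block
blockOf []       x = []
blockOf (B ∷ Bs) x with x ∈? B
... | yes _ = B
... | no  _ = blockOf Bs x

blockOf-unique : ∀ {x B} Q → occ x (concat Q) ≤ 1 → B ∈ Q → x ∈ B → blockOf Q x ≡ B
blockOf-unique {x} (D ∷ Q) occ≤1 B∈ x∈B with x ∈? D
... | yes x∈D = ∈-concat-unique (D ∷ Q) occ≤1 (here refl) B∈ x∈D x∈B
blockOf-unique {x} (D ∷ Q) occ≤1 (here refl) x∈B | no x∉D = contradiction x∈B x∉D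
blockOf-unique {x} (D ∷ Q) occ≤1 (there B∈) x∈B | no _ =
  blockOf-unique Q (≤-trans (m≤n+m _ _) (subst (_≤ 1) (countᵇ-++ _ D (concat Q)) occ≤1)) B∈ x∈B

endLetters : ℕ → ℕ → ℕ → Word
endLetters first last x = (if first ≡ᵇ x then U else R) ∷ (if last ≡ᵇ x then R else U) ∷ []

blockLetters : Block → ℕ → Word
blockLetters B = endLetters (minB B) (lastB B)

-- D (b ∷ bs) = U (UR)^|bs| R regroups as UU (RU)^(|bs|-1) RR: the letters of b, the middle elements and the last one
endLetters-tail : ∀ b y ys → Increasing (y ∷ ys) → b < y →
  concatMap (endLetters b (lastB (y ∷ ys))) (y ∷ ys) ≡ R ∷ concat (replicate (length ys) (U ∷ R ∷ [])) ++ R ∷ []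
endLetters-tail b y [] _ b<y rewrite ≡ᵇ-false (<⇒≢ b<y) | ≡ᵇ-refl y = refl
endLetters-tail b y (z ∷ zs) (y<z∷zs ∷ z∷zs-increasing) b<y
  rewrite ≡ᵇ-false (<⇒≢ b<y)
        | ≡ᵇ-false (>⇒≢ (<-≤-trans (All.lookup y<z∷zs (here refl)) (≤lastB z∷zs-increasing (here refl)))) =
  cong (λ w → R ∷ U ∷ w) (endLetters-tail b z zs z∷zs-increasing (<-trans b<y (All.lookup y<z∷zs (here refl))))

D-blockLetters : ∀ {B} → Increasing B → D B ≡ concatMap (blockLetters B) B
D-blockLetters {[]} _ = refl
D-blockLetters {b ∷ []} _ rewrite ≡ᵇ-refl b = refl
D-blockLetters {b ∷ c ∷ cs} (b<c∷cs ∷ c∷cs-increasing)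
  rewrite ≡ᵇ-refl b
        | ≡ᵇ-false (>⇒≢ (<-≤-trans (All.lookup b<c∷cs (here refl)) (≤lastB c∷cs-increasing (here refl)))) =
  cong (λ w → U ∷ U ∷ w) (sym (endLetters-tail b c cs c∷cs-increasing (All.lookup b<c∷cs (here refl))))

module PartitionFacts {n : ℕ} {π : Partition} (isP : IsPartition n π) where
  open IsPartition isP

  ∈-concat⇒∈-range : ∀ {x} → x ∈ concat π → x ∈ range n
  ∈-concat⇒∈-range = ∈-resp-↭ coversExactly

  ∈-range⇒∈-concat : ∀ {x} → x ∈ range n → x ∈ concat π
  ∈-range⇒∈-concat = ∈-resp-↭ (↭-sym coversExactly)

  block⊆range : ∀ {B x} → B ∈ π → x ∈ B → x ∈ range n
  block⊆range B∈ x∈ = ∈-concat⇒∈-range (∈-concat⁺′ x∈ B∈)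

  block-increasing : ∀ {B} → B ∈ π → Increasing B
  block-increasing B∈ = Linked⇒AllPairs <-trans (All.lookup blocksIncreasing B∈)

  minB∈block : ∀ {B} → B ∈ π → minB B ∈ B
  minB∈block B∈ with All.lookup blocksNonEmpty B∈
  ... | nonEmpty = here refl

  lastB∈block : ∀ {B} → B ∈ π → lastB B ∈ B
  lastB∈block B∈ with All.lookup blocksNonEmpty B∈
  ... | nonEmpty {x} {xs} = lastB∈ x xs

  occ-concat≤1 : ∀ x → occ x (concat π) ≤ 1
  occ-concat≤1 x = subst (_≤ 1) (sym (countᵇ-↭ _ coversExactly)) occ-range≤1
    where
    occ-range≤1 : occ x (range n) ≤ 1
    occ-range≤1 with x ∈? range n
    ... | yes x∈ = ≤-reflexive (occ-increasing (range-increasing n) x∈)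
    ... | no  x∉ = subst (_≤ 1) (sym (occ-∉ (range n) x∉)) z≤n

  block-unique : ∀ {x B C} → B ∈ π → C ∈ π → x ∈ B → x ∈ C → B ≡ C
  block-unique {x} = ∈-concat-unique π (occ-concat≤1 x)

  blockOf-≡ : ∀ {x B} → B ∈ π → x ∈ B → blockOf π x ≡ B
  blockOf-≡ {x} = blockOf-unique π (occ-concat≤1 x)

  blockOf-∈ : ∀ {x} → x ∈ range n → blockOf π x ∈ π × x ∈ blockOf π x
  blockOf-∈ {x} x∈ with ∈-concat⁻′ π (∈-range⇒∈-concat x∈)
  ... | B , x∈B , B∈ rewrite blockOf-≡ B∈ x∈B = B∈ , x∈B

  isFirst isLast : ℕ → Bool
  isFirst x = minB (blockOf π x) ≡ᵇ x
  isLast x = lastB (blockOf π x) ≡ᵇ x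

  letters : ℕ → Word
  letters x = blockLetters (blockOf π x) x

  First Last : ℕ → Set
  First x = ∀ {a} → a ∈ blockOf π x → x ≤ a
  Last x = ∀ {a} → a ∈ blockOf π x → a ≤ x

  isFirst-true⁻ : ∀ {x} → x ∈ range n → isFirst x ≡ true → First x
  isFirst-true⁻ x∈ first a∈ =
    subst (_≤ _) (≡ᵇ-true⁻ first) (minB≤ (block-increasing (proj₁ (blockOf-∈ x∈))) a∈)

  isFirst-true⁺ : ∀ {x} → x ∈ range n → First x → isFirst x ≡ true
  isFirst-true⁺ {x} x∈ first with blockOf-∈ x∈
  ... | B∈ , x∈B = subst (λ t → (t ≡ᵇ x) ≡ true)
    (≤-antisym (first (minB∈block B∈)) (minB≤ (block-increasing B∈) x∈B)) (≡ᵇ-refl x)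

  isLast-true⁻ : ∀ {x} → x ∈ range n → isLast x ≡ true → Last x
  isLast-true⁻ x∈ last a∈ =
    subst (_ ≤_) (≡ᵇ-true⁻ last) (≤lastB (block-increasing (proj₁ (blockOf-∈ x∈))) a∈)

  isLast-true⁺ : ∀ {x} → x ∈ range n → Last x → isLast x ≡ true
  isLast-true⁺ {x} x∈ last with blockOf-∈ x∈
  ... | B∈ , x∈B = subst (λ t → (t ≡ᵇ x) ≡ true)
    (≤-antisym (≤lastB (block-increasing B∈) x∈B) (last (lastB∈block B∈))) (≡ᵇ-refl x)

  Last-n : 1 ≤ n → Last n
  Last-n 1≤n a∈ = proj₂ (∈-range⁻ (block⊆range (proj₁ (blockOf-∈ (∈-range⁺ 1≤n ≤-refl))) a∈))

  SameBlock-≡ : ∀ {u v B C} → SameBlock π u v → C ∈ π → B ∈ π → u ∈ C → v ∈ B → C ≡ B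
  SameBlock-≡ (D , D∈ , u∈D , v∈D) C∈ B∈ u∈C v∈B = trans (block-unique C∈ D∈ u∈C u∈D) (block-unique D∈ B∈ v∈D v∈B)

  SameRegion-ahead⇒First : ∀ {i j} → i ∈ range n → i < j → SameRegion π i j → First i
  SameRegion-ahead⇒First i∈ i<j same a∈ with blockOf-∈ i∈
  ... | B∈ , i∈B = proj₁ (SameRegion-confines (<⇒≤ i<j) same B∈ i∈B a∈ ≤-refl i<j)

  SameRegion-1⇒First : ∀ {i} → i ∈ range n → SameRegion π 1 i → First i
  SameRegion-1⇒First {i} i∈ same {a} a∈ with blockOf-∈ i∈ | a <? i
  ... | _      | no a≮i  = ≮⇒≥ a≮i
  ... | B∈ , i∈B | yes a<i = contradiction
    (proj₂ (SameRegion-confines (proj₁ (∈-range⁻ i∈)) same B∈ a∈ i∈B (proj₁ (∈-range⁻ (block⊆range B∈ a∈))) a<i))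
    (<-irrefl refl)

  SameRegion-behind⇒Last : ∀ {t k} → k ∈ range n → t ≤ k → SameRegion π t (suc k) → Last k
  SameRegion-behind⇒Last k∈ t≤k same a∈ with blockOf-∈ k∈
  ... | B∈ , k∈B = ≤-pred (proj₂ (SameRegion-confines (m≤n⇒m≤1+n t≤k) same B∈ k∈B a∈ t≤k ≤-refl))

  SameRegion-whole : SameRegion π 1 (suc n)
  SameRegion-whole = sameRegion⁺ λ B∈ x∈ y∈ → trans (on-whole B∈ x∈) (sym (on-whole B∈ y∈))
    where
    on-whole : ∀ {B x} → B ∈ π → x ∈ B → onArc 1 (suc n) x ≡ true
    on-whole B∈ x∈ with ∈-range⁻ (block⊆range B∈ x∈)
    ... | 1≤x , x≤n = onArc-inside 1≤x (s≤s x≤n)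

  ∈-span : ∀ {B y} → B ∈ π → y ∈ B → minB B ≤ y × y ≤ lastB B
  ∈-span B∈ y∈ = minB≤ (block-increasing B∈) y∈ , ≤lastB (block-increasing B∈) y∈

  span-SameBlock : ∀ {B} → B ∈ π → SameBlock π (minB B) (lastB B)
  span-SameBlock B∈ = _ , B∈ , minB∈block B∈ , lastB∈block B∈

  module _ (nc : NonCrossing π) where

    -- non-crossing applied to y < min B < x < last B, or to min B < x < last B < y
    inside-or-same : ∀ {B C x y} → B ∈ π → C ∈ π → x ∈ C → y ∈ C →
      minB B ≤ x → x ≤ lastB B → C ≡ B ⊎ (minB B ≤ y × y ≤ lastB B)
    inside-or-same {B} {C} {x} {y} B∈ C∈ x∈C y∈C b≤x x≤l with minB B ≟ x | lastB B ≟ x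
    ... | yes refl | _        = inj₁ (block-unique C∈ B∈ x∈C (minB∈block B∈))
    ... | no _     | yes refl = inj₁ (block-unique C∈ B∈ x∈C (lastB∈block B∈))
    ... | no b≢x   | no l≢x with y <? minB B | lastB B <? y
    ...   | yes y<b | _       = inj₁ (SameBlock-≡ (nc _ _ _ _ y<b b<x x<l (C , C∈ , y∈C , x∈C) (span-SameBlock B∈))
                                                  C∈ B∈ y∈C (minB∈block B∈))
      where
      b<x = ≤∧≢⇒< b≤x b≢x
      x<l = ≤∧≢⇒< x≤l (l≢x ∘ sym)
    ...   | no _    | yes l<y = inj₁ (sym (SameBlock-≡ (nc _ _ _ _ b<x x<l l<y (span-SameBlock B∈) (C , C∈ , x∈C , y∈C))
                                                       B∈ C∈ (minB∈block B∈) x∈C))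
      where
      b<x = ≤∧≢⇒< b≤x b≢x
      x<l = ≤∧≢⇒< x≤l (l≢x ∘ sym)
    ...   | no y≮b  | no l≮y  = inj₂ (≮⇒≥ y≮b , ≮⇒≥ l≮y)

    nested : ∀ {B C x y} → B ∈ π → C ∈ π → x ∈ C → y ∈ C →
      minB B ≤ x → x ≤ lastB B → minB B ≤ y × y ≤ lastB B
    nested {y = y} B∈ C∈ x∈C y∈C b≤x x≤l with inside-or-same B∈ C∈ x∈C y∈C b≤x x≤l
    ... | inj₁ C≡B   = ∈-span B∈ (subst (y ∈_) C≡B y∈C)
    ... | inj₂ inside = inside

    span-SameRegion : ∀ {B} → B ∈ π → SameRegion π (minB B) (suc (lastB B))
    span-SameRegion {B} B∈ = sameRegion⁺ λ C∈ x∈ y∈ → ≡-from-true⇔ (inward C∈ x∈ y∈) (inward C∈ y∈ x∈)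
      where
      b≤l+1 : minB B ≤ suc (lastB B)
      b≤l+1 = m≤n⇒m≤1+n (≤lastB (block-increasing B∈) (minB∈block B∈))
      inward : ∀ {C x y} → C ∈ π → x ∈ C → y ∈ C →
        onArc (minB B) (suc (lastB B)) x ≡ true → onArc (minB B) (suc (lastB B)) y ≡ true
      inward C∈ x∈ y∈ x-on with onArc-true⁻ b≤l+1 x-on
      ... | b≤x , x<l+1 with nested B∈ C∈ x∈ y∈ b≤x (≤-pred x<l+1)
      ...   | b≤y , y≤l = onArc-inside b≤y (s≤s y≤l)

    First⇒SameRegion-1 : ∀ {i} → i ∈ range n → First i → (∀ {t} → t ∈ range n → SameRegion π i t → t ≤ i) →
      SameRegion π i 1
    First⇒SameRegion-1 {i} i∈ first maximal = SameRegion-trans (subst (λ l → SameRegion π i (suc l)) l≡n i~l+1)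
                                                              (SameRegion-sym SameRegion-whole)
      where
      B∈ = proj₁ (blockOf-∈ i∈)
      i∈B = proj₂ (blockOf-∈ i∈)
      i~l+1 : SameRegion π i (suc (lastB (blockOf π i)))
      i~l+1 = subst (λ b → SameRegion π b (suc (lastB (blockOf π i)))) (≡ᵇ-true⁻ (isFirst-true⁺ i∈ first))
                    (span-SameRegion B∈)
      -- the region of i' also contains (l+1)', which must then lie beyond n
      l≡n : lastB (blockOf π i) ≡ n
      l≡n with lastB (blockOf π i) <? n
      ... | yes l<n = contradiction (maximal (∈-range⁺ (s≤s z≤n) l<n) i~l+1) (<⇒≱ (s≤s (≤lastB (block-increasing B∈) i∈B)))
      ... | no  l≮n = ≤-antisym (proj₂ (∈-range⁻ (block⊆range B∈ (lastB∈block B∈)))) (≮⇒≥ l≮n)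

    Last⇒SameRegion : ∀ {k} → k ∈ range n → Last k → SameRegion π (suc k) (minB (blockOf π k))
    Last⇒SameRegion {k} k∈ last = SameRegion-sym (subst (λ l → SameRegion π (minB (blockOf π k)) (suc l))
                                                        (≡ᵇ-true⁻ (isLast-true⁺ k∈ last))
                                                        (span-SameRegion (proj₁ (blockOf-∈ k∈))))

-- The word κ π

module KappaWord {n : ℕ} {π : Partition} (isP : IsPartition n π) (nc : NonCrossing π) where
  open IsPartition isP
  open PartitionFacts isP

  D-letters : ∀ {B} → B ∈ π → D B ≡ concatMap letters B
  D-letters {B} B∈ = trans (D-blockLetters (block-increasing B∈))
    (cong concat (map-cong-local (All.tabulate λ {x} x∈ → cong (λ C → blockLetters C x) (sym (blockOf-≡ B∈ x∈)))))

  record Built (done : Partition) (P : Word) : Set where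
    field
      elements   : List ℕ
      increasing : Increasing elements
      sound      : ∀ {x} → x ∈ elements → x ∈ concat done
      complete   : ∀ {x} → x ∈ concat done → x ∈ elements
      word       : P ≡ concatMap letters elements

  -- the done elements below min B are 1, …, min B - 1, and the others exceed last B by non-crossing
  module Insertion {done B rest} (π≡ : π ≡ done ++ B ∷ rest) where

    B∈π : B ∈ π
    B∈π = subst (B ∈_) (sym π≡) (∈-++⁺ʳ done (here refl))

    done⊆π : ∀ {C} → C ∈ done → C ∈ π
    done⊆π C∈ = subst (_ ∈_) (sym π≡) (∈-++⁺ˡ C∈)

    mins : AllPairs _<_ (map minB done ++ minB B ∷ map minB rest)
    mins = subst (AllPairs _<_) (trans (cong (map minB) π≡) (map-++ minB done (B ∷ rest)))
                 (Linked⇒AllPairs <-trans minsIncreasing)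

    done-before : ∀ {C} → C ∈ done → minB C < minB B
    done-before C∈ = AllPairs-before (map minB done) mins (∈-map⁺ minB C∈)

    rest-after : ∀ {C} → C ∈ rest → minB B < minB C
    rest-after C∈ = AllPairs-after (map minB done) mins (∈-map⁺ minB C∈)

    b = minB B
    l = lastB B

    1≤b : 1 ≤ b
    1≤b = proj₁ (∈-range⁻ (block⊆range B∈π (minB∈block B∈π)))

    concat-done⊆range : ∀ {y} → y ∈ concat done → y ∈ range n
    concat-done⊆range y∈ with ∈-concat⁻′ done y∈
    ... | C , y∈C , C∈ = block⊆range (done⊆π C∈) y∈C

    below-done : ∀ {y} → y ∈ range n → y < b → y ∈ concat done
    below-done {y} y∈ y<b with ∈-concat⁻′ π (∈-range⇒∈-concat y∈)
    ... | C , y∈C , C∈π with ∈-++⁻ done (subst (C ∈_) π≡ C∈π)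
    ...   | inj₁ C∈done         = ∈-concat⁺′ y∈C C∈done
    ...   | inj₂ (here refl)    = contradiction (minB≤ (block-increasing C∈π) y∈C) (<⇒≱ y<b)
    ...   | inj₂ (there C∈rest) =
      contradiction (≤-<-trans (minB≤ (block-increasing C∈π) y∈C) y<b) (<-asym (rest-after C∈rest))

    done-outside : ∀ {y} → y ∈ concat done → y < b ⊎ l < y
    done-outside {y} y∈ with y <? b | l <? y
    ... | yes y<b | _       = inj₁ y<b
    ... | no  _   | yes l<y = inj₂ l<y
    ... | no  y≮b | no  l≮y with ∈-concat⁻′ done y∈
    ...   | C , y∈C , C∈ = contradiction
      (proj₁ (nested nc B∈π (done⊆π C∈) y∈C (minB∈block (done⊆π C∈)) (≮⇒≥ y≮b) (≮⇒≥ l≮y)))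
      (<⇒≱ (done-before C∈))

    b∉done : b ∉ concat done
    b∉done b∈ with done-outside b∈
    ... | inj₁ b<b = <-irrefl refl b<b
    ... | inj₂ l<b = <⇒≱ l<b (≤lastB (block-increasing B∈π) (minB∈block B∈π))

    module _ {P} (built : Built done P) {lo hi} (K≡ : Built.elements built ≡ lo ++ hi)
             (lo<b : All (_< b) lo) (b<hi : All (b <_) hi) where
      open Built built

      lo-increasing : Increasing lo
      lo-increasing = proj₁ (AllPairs-++⁻ lo (subst Increasing K≡ increasing))

      hi-increasing : Increasing hi
      hi-increasing = proj₂ (AllPairs-++⁻ lo (subst Increasing K≡ increasing))

      ∈-lo : ∀ {y} → y ∈ lo → y ∈ concat done
      ∈-lo y∈ = sound (subst (_ ∈_) (sym K≡) (∈-++⁺ˡ y∈))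

      ∈-hi : ∀ {y} → y ∈ hi → y ∈ concat done
      ∈-hi y∈ = sound (subst (_ ∈_) (sym K≡) (∈-++⁺ʳ lo y∈))

      lo≡range : lo ≡ range (b ∸ 1)
      lo≡range = increasing-≡ lo-increasing (range-increasing (b ∸ 1)) lo⊆ ⊆lo
        where
        b-1+1 : suc (b ∸ 1) ≡ b
        b-1+1 = m+[n∸m]≡n 1≤b
        lo⊆ : ∀ {y} → y ∈ lo → y ∈ range (b ∸ 1)
        lo⊆ {y} y∈ = ∈-range⁺ (proj₁ (∈-range⁻ (concat-done⊆range (∈-lo y∈))))
                               (≤-pred (subst (y <_) (sym b-1+1) (All.lookup lo<b y∈)))
        ⊆lo : ∀ {y} → y ∈ range (b ∸ 1) → y ∈ lo
        ⊆lo {y} y∈ = from-elements (∈-++⁻ lo (subst (y ∈_) K≡ (complete (below-done y∈range y<b))))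
          where
          y<b : y < b
          y<b = subst (y <_) b-1+1 (s≤s (proj₂ (∈-range⁻ y∈)))
          y∈range : y ∈ range n
          y∈range = ∈-range⁺ (proj₁ (∈-range⁻ y∈)) (≤-trans (<⇒≤ y<b) (proj₂ (∈-range⁻ (block⊆range B∈π (minB∈block B∈π)))))
          from-elements : y ∈ lo ⊎ y ∈ hi → y ∈ lo
          from-elements (inj₁ y∈lo) = y∈lo
          from-elements (inj₂ y∈hi) = contradiction (All.lookup b<hi y∈hi) (<-asym y<b)

      l<hi : All (l <_) hi
      l<hi = All.tabulate λ {y} y∈ → [ (λ y<b → contradiction (All.lookup b<hi y∈) (<-asym y<b)) , (λ l<y → l<y) ]′
                                      (done-outside (∈-hi y∈))

      extended : List ℕ
      extended = lo ++ B ++ hi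

      extended-increasing : Increasing extended
      extended-increasing = AllPairsₚ.++⁺ lo-increasing (AllPairsₚ.++⁺ (block-increasing B∈π) hi-increasing B<hi)
        (All.map (λ y<b → Allₚ.++⁺ (All.tabulate (<-≤-trans y<b ∘ minB≤ (block-increasing B∈π)))
                                    (All.map (<-trans y<b) b<hi)) lo<b)
        where
        B<hi : All (λ x → All (x <_) hi) B
        B<hi = All.tabulate λ x∈ → All.map (≤-<-trans (≤lastB (block-increasing B∈π) x∈)) l<hi

      extended-word : κstep P B ≡ concatMap letters extended
      extended-word = begin
        insertAfter (2 * (b ∸ 1)) (D B) P
          ≡⟨ cong₂ (λ k w → insertAfter k (D B) w) 2[b-1]≡ P≡ ⟩
        insertAfter (length (concatMap letters lo)) (D B) (concatMap letters lo ++ concatMap letters hi)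
          ≡⟨ insertAfter-++ (D B) (concatMap letters lo) (concatMap letters hi) ⟩
        concatMap letters lo ++ D B ++ concatMap letters hi
          ≡⟨ cong (λ w → concatMap letters lo ++ w ++ concatMap letters hi) (D-letters B∈π) ⟩
        concatMap letters lo ++ concatMap letters B ++ concatMap letters hi
          ≡⟨ cong (concatMap letters lo ++_) (concatMap-++ letters B hi) ⟨
        concatMap letters lo ++ concatMap letters (B ++ hi)
          ≡⟨ concatMap-++ letters lo (B ++ hi) ⟨
        concatMap letters extended
          ∎
        where
        open ≡-Reasoning
        2[b-1]≡ : 2 * (b ∸ 1) ≡ length (concatMap letters lo)
        2[b-1]≡ = sym (trans (length-concatMap-pairs letters lo (λ _ → refl))
                             (cong (2 *_) (trans (cong length lo≡range) (length-range (b ∸ 1)))))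
        P≡ : P ≡ concatMap letters lo ++ concatMap letters hi
        P≡ = trans word (trans (cong (concatMap letters) K≡) (concatMap-++ letters lo hi))

      concat-done-B : concat (done ++ [ B ]) ≡ concat done ++ B ++ []
      concat-done-B = sym (concat-++ done [ B ])

      extended-sound : ∀ {y} → y ∈ extended → y ∈ concat (done ++ [ B ])
      extended-sound {y} y∈ = subst (y ∈_) (sym concat-done-B) (from-extended (∈-++⁻ lo y∈))
        where
        from-extended : y ∈ lo ⊎ y ∈ B ++ hi → y ∈ concat done ++ B ++ []
        from-extended (inj₁ y∈lo) = ∈-++⁺ˡ (∈-lo y∈lo)
        from-extended (inj₂ y∈B++hi) with ∈-++⁻ B y∈B++hi
        ... | inj₁ y∈B  = ∈-++⁺ʳ (concat done) (∈-++⁺ˡ y∈B)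
        ... | inj₂ y∈hi = ∈-++⁺ˡ (∈-hi y∈hi)

      extended-complete : ∀ {y} → y ∈ concat (done ++ [ B ]) → y ∈ extended
      extended-complete {y} y∈ with ∈-++⁻ (concat done) (subst (y ∈_) concat-done-B y∈)
      ... | inj₁ y∈done with ∈-++⁻ lo (subst (y ∈_) K≡ (complete y∈done))
      ...   | inj₁ y∈lo = ∈-++⁺ˡ y∈lo
      ...   | inj₂ y∈hi = ∈-++⁺ʳ lo (∈-++⁺ʳ B y∈hi)
      extended-complete {y} y∈ | inj₂ y∈B++[] with ∈-++⁻ B y∈B++[]
      ... | inj₁ y∈B = ∈-++⁺ʳ lo (∈-++⁺ˡ y∈B)
      ... | inj₂ ()

      extend : Built (done ++ [ B ]) (κstep P B)
      extend = record
        { elements = extended ; increasing = extended-increasing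
        ; sound = extended-sound ; complete = extended-complete ; word = extended-word }

    step : ∀ {P} → Built done P → Built (done ++ [ B ]) (κstep P B)
    step built with increasing-split (Built.increasing built) (b∉done ∘ Built.sound built)
    ... | lo , hi , K≡ , lo<b , b<hi = extend built K≡ lo<b b<hi

  foldl-Built : ∀ done rest {P} → π ≡ done ++ rest → Built done P → Built π (foldl κstep P rest)
  foldl-Built done []         π≡ built = subst (λ d → Built d _) (sym (trans π≡ (++-identityʳ done))) built
  foldl-Built done (B ∷ rest) π≡ built =
    foldl-Built (done ++ [ B ]) rest (trans π≡ (sym (++-assoc done [ B ] rest))) (Insertion.step π≡ built)

  Built-block : ∀ {B} → B ∈ π → Built [ B ] (D B)
  Built-block {B} B∈ = record
    { elements = B ; increasing = block-increasing B∈
    ; sound = ∈-++⁺ˡ ; complete = λ y∈ → [ (λ y∈B → y∈B) , (λ ()) ]′ (∈-++⁻ B y∈) ; word = D-letters B∈ }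

  Built-all : ∀ {P} → Built π P → P ≡ concatMap letters (range n)
  Built-all built = trans word (cong (concatMap letters)
    (increasing-≡ increasing (range-increasing n) (∈-concat⇒∈-range ∘ sound) (complete ∘ ∈-range⇒∈-concat)))
    where open Built built

  κ-letters : 1 ≤ n → κ π ≡ concatMap letters (range n)
  κ-letters 1≤n = κ-Built π refl
    where
    κ-Built : ∀ Q → π ≡ Q → κ Q ≡ concatMap letters (range n)
    κ-Built []         π≡[] =
      contradiction (subst (λ Q → 1 ∈ concat Q) π≡[] (∈-range⇒∈-concat (∈-range⁺ ≤-refl 1≤n))) λ ()
    κ-Built (B ∷ rest) π≡   = Built-all (foldl-Built [ B ] rest π≡ (Built-block (subst (B ∈_) (sym π≡) (here refl))))

-- The chord diagram of ρ n π

pos-pt : ∀ a → pos (pt (suc a)) ≡ suc (2 * a)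
pos-pt a = cong (_∸ 1) (*-suc 2 a)

odd≢even : ∀ a b → suc (2 * a) ≢ 2 * b
odd≢even a       zero    ()
odd≢even zero    (suc b) 1≡2[1+b] with () ← trans 1≡2[1+b] (*-suc 2 b)
odd≢even (suc a) (suc b) e =
  odd≢even a b (suc-injective (suc-injective (trans (cong suc (sym (*-suc 2 a))) (trans e (*-suc 2 b)))))

pt<pt' : ∀ {a b} → a < b → pos (pt (suc a)) < pos (pt' b)
pt<pt' {a} {suc b} (s≤s a≤b) rewrite pos-pt a | *-suc 2 b = s≤s (s≤s (*-monoʳ-≤ 2 a≤b))

pt'<pt : ∀ {a b} → b ≤ a → pos (pt' b) < pos (pt (suc a))
pt'<pt {a} b≤a rewrite pos-pt a = s≤s (*-monoʳ-≤ 2 b≤a)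

min-end : ∀ {u v} → u < v → ((u ⊓ v) ≡ᵇ u) ≡ true × ((u ⊔ v) ≡ᵇ u) ≡ false
min-end {u} u<v rewrite m≤n⇒m⊓n≡m (<⇒≤ u<v) | m≤n⇒m⊔n≡n (<⇒≤ u<v) = ≡ᵇ-refl u , ≡ᵇ-false (>⇒≢ u<v)

max-end : ∀ {u v} → u < v → ((u ⊓ v) ≡ᵇ v) ≡ false × ((u ⊔ v) ≡ᵇ v) ≡ true
max-end {u} {v} u<v rewrite m≤n⇒m⊓n≡m (<⇒≤ u<v) | m≤n⇒m⊔n≡n (<⇒≤ u<v) = ≡ᵇ-false (<⇒≢ u<v) , ≡ᵇ-refl v

no-end : ∀ {u v x} → u ≢ x → v ≢ x → ((u ⊓ v) ≡ᵇ x) ≡ false × ((u ⊔ v) ≡ᵇ x) ≡ false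
no-end {u} {v} u≢x v≢x with ≤-total u v
... | inj₁ u≤v rewrite m≤n⇒m⊓n≡m u≤v | m≤n⇒m⊔n≡n u≤v = ≡ᵇ-false u≢x , ≡ᵇ-false v≢x
... | inj₂ v≤u rewrite m≥n⇒m⊓n≡n v≤u | m≥n⇒m⊔n≡m v≤u = ≡ᵇ-false v≢x , ≡ᵇ-false u≢x

pos-pt-injective : ∀ {a b} → 1 ≤ a → 1 ≤ b → pos (pt a) ≡ pos (pt b) → a ≡ b
pos-pt-injective {suc a} {suc b} _ _ e =
  cong suc (*-cancelˡ-≡ a b 2 (suc-injective (trans (sym (pos-pt a)) (trans e (pos-pt b)))))

pt≢pt' : ∀ {a} → 1 ≤ a → ∀ k → pos (pt a) ≢ pos (pt' k)
pt≢pt' {suc a} _ k e = odd≢even a k (trans (sym (pos-pt a)) e)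

pt≢predPrime : ∀ {a} → 1 ≤ a → ∀ n j → pos (pt a) ≢ pos (predPrime n j)
pt≢predPrime 1≤a n zero          = pt≢pt' 1≤a n
pt≢predPrime 1≤a n (suc zero)    = pt≢pt' 1≤a n
pt≢predPrime 1≤a n (suc (suc j)) = pt≢pt' 1≤a (suc j)

module RegionPairs {n : ℕ} {π : Partition} (isP : IsPartition n π) where
  open PartitionFacts isP

  open Classes (sameRegion π) (range n) (range-increasing n)
    (sameRegion-refl {π}) (sameRegion-sym {π}) (sameRegion-trans {π})

  Pairs : List (ℕ × ℕ)
  Pairs = concatMap cyclicPairs (ρ n π)

  count-first : ∀ {i} → i ∈ range n → countᵇ (λ p → proj₁ p ≡ᵇ i) Pairs ≡ 1
  count-first {i} i∈ = begin
    countᵇ (λ p → proj₁ p ≡ᵇ i) Pairs   ≡⟨ countᵇ-map (_≡ᵇ i) proj₁ Pairs ⟨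
    occ i (map proj₁ Pairs)             ≡⟨ cong (occ i) (map-proj₁-concatMap-cyclicPairs (ρ n π)) ⟩
    occ i (concat classes)              ≡⟨ occ-classes i∈ ⟩
    1                                   ∎
    where open ≡-Reasoning

  count-second : ∀ {i} → i ∈ range n → countᵇ (λ p → proj₂ p ≡ᵇ i) Pairs ≡ 1
  count-second {i} i∈ = begin
    countᵇ (λ p → proj₂ p ≡ᵇ i) Pairs   ≡⟨ countᵇ-map (_≡ᵇ i) proj₂ Pairs ⟨
    occ i (map proj₂ Pairs)             ≡⟨ occ-proj₂-concatMap-cyclicPairs i (ρ n π) ⟩
    occ i (concat classes)              ≡⟨ occ-classes i∈ ⟩
    1                                   ∎
    where open ≡-Reasoning

  -- consecutive elements of a class of ρ n π, or the pair closing the cycle from its largest to its least element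
  data Shape (a j : ℕ) : Set where
    consecutive : a < j → Shape a j
    closing     : j ≤ a → (∀ {t} → t ∈ range n → SameRegion π a t → t ≤ a) →
                  (∀ {t} → t ∈ range n → SameRegion π j t → j ≤ t) → Shape a j

  ∈-Pairs⁻ : ∀ {a j} → (a , j) ∈ Pairs → a ∈ range n × j ∈ range n × SameRegion π a j × Shape a j
  ∈-Pairs⁻ {a} {j} p∈ with ∈-concat⁻′ (map cyclicPairs (ρ n π)) p∈
  ... | _ , p∈cp , cp∈ with ∈-map⁻ cyclicPairs cp∈
  ...   | C , C∈ , refl with ∈-classes⁻ C∈
  ...     | m , refl = from-class (class m) refl p∈cp
    where
    in-class : ∀ {C t} → C ≡ class m → t ∈ C → t ∈ range n × SameRegion π m t
    in-class refl t∈ with ∈-class⁻ m t∈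
    ... | t∈range , m~t = t∈range , sameRegion⇒SameRegion {π} {m} m~t
    into-class : ∀ {C t} → C ≡ class m → t ∈ range n → SameRegion π m t → t ∈ C
    into-class refl t∈ m~t = ∈-class⁺ m t∈ (SameRegion⇒sameRegion m~t)
    related : ∀ {C x y} → C ≡ class m → x ∈ C → y ∈ C → SameRegion π x y
    related C≡ x∈ y∈ = SameRegion-trans (SameRegion-sym (proj₂ (in-class C≡ x∈))) (proj₂ (in-class C≡ y∈))
    class-increasing : ∀ {C} → C ≡ class m → Increasing C
    class-increasing refl = filterᵇ-increasing _ (range-increasing n)
    from-class : ∀ C → C ≡ class m → (a , j) ∈ cyclicPairs C →
      a ∈ range n × j ∈ range n × SameRegion π a j × Shape a j
    from-class (b ∷ bs) C≡ p∈ with ∈-cyclicPairs⁻ b bs (class-increasing C≡) p∈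
    ... | inj₁ (a<j , a∈ , j∈) = proj₁ (in-class C≡ a∈) , proj₁ (in-class C≡ j∈) , related C≡ a∈ j∈ , consecutive a<j
    ... | inj₂ (refl , refl) =
      proj₁ (in-class C≡ last∈) , proj₁ (in-class C≡ (here refl)) , related C≡ last∈ (here refl) ,
      closing (minB≤ (class-increasing C≡) last∈)
              (λ t∈ last~t → ≤lastB (class-increasing C≡)
                               (into-class C≡ t∈ (SameRegion-trans (proj₂ (in-class C≡ last∈)) last~t)))
              (λ t∈ b~t → minB≤ (class-increasing C≡)
                            (into-class C≡ t∈ (SameRegion-trans (proj₂ (in-class C≡ (here refl))) b~t)))
      where
      last∈ = lastB∈ b bs

  module _ (nc : NonCrossing π) where

    point-orientation : ∀ {i j} → (i , j) ∈ Pairs →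
      (isFirst i ≡ true × pos (pt i) < pos (predPrime n j)) ⊎ (isFirst i ≡ false × pos (predPrime n j) < pos (pt i))
    point-orientation {i} {j} p∈ with ∈-Pairs⁻ p∈
    point-orientation {suc i} {suc (suc j)} p∈ | i∈ , _ , i~j , consecutive i<j =
      inj₁ (isFirst-true⁺ i∈ (SameRegion-ahead⇒First i∈ i<j i~j) , pt<pt' (≤-pred i<j))
    point-orientation {suc i} {suc zero} p∈ | i∈ , _ , i~j , closing _ _ _ =
      inj₁ (isFirst-true⁺ i∈ (SameRegion-1⇒First i∈ (SameRegion-sym i~j)) ,
            pt<pt' (proj₂ (∈-range⁻ i∈)))
    point-orientation {suc i} {suc (suc j)} p∈ | i∈ , j∈ , i~j , closing j≤i maximal minimal =
      inj₂ (not-first , pt'<pt (≤-pred j≤i))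
      where
      -- otherwise the region of i' would contain 1', below its least element j+2
      not-first : isFirst (suc i) ≡ false
      not-first with isFirst (suc i) in first
      ... | false = refl
      ... | true  = contradiction (minimal (∈-range⁺ ≤-refl (≤-trans (s≤s z≤n) (proj₂ (∈-range⁻ i∈))))
                      (SameRegion-trans (SameRegion-sym i~j) (First⇒SameRegion-1 nc i∈ (isFirst-true⁻ i∈ first) maximal)))
                      (<⇒≱ (s≤s (s≤s z≤n)))
    point-orientation {zero} p∈ | i∈ , _ = contradiction (proj₁ (∈-range⁻ i∈)) λ ()
    point-orientation {suc i} {zero} p∈ | _ , j∈ , _ = contradiction (proj₁ (∈-range⁻ j∈)) λ ()
    point-orientation {suc i} {suc zero} p∈ | _ , _ , _ , consecutive (s≤s ())

    prime-orientation : ∀ {a k} → (a , suc k) ∈ Pairs → 1 ≤ k →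
      (isLast k ≡ true × pos (pt a) < pos (pt' k)) ⊎ (isLast k ≡ false × pos (pt' k) < pos (pt a))
    prime-orientation {a} {k} p∈ 1≤k with ∈-Pairs⁻ p∈
    prime-orientation {zero} p∈ _ | a∈ , _ = contradiction (proj₁ (∈-range⁻ a∈)) λ ()
    prime-orientation {suc a} {k} p∈ 1≤k | _ , k+1∈ , a~k+1 , consecutive a<k+1 =
      inj₁ (isLast-true⁺ k∈ (SameRegion-behind⇒Last k∈ (≤-pred a<k+1) a~k+1) , pt<pt' (≤-pred a<k+1))
      where k∈ = ∈-range⁺ 1≤k (<⇒≤ (proj₂ (∈-range⁻ k+1∈)))
    prime-orientation {suc a} {k} p∈ 1≤k | _ , k+1∈ , _ , closing k+1≤a _ minimal =
      inj₂ (not-last , pt'<pt (≤-pred k+1≤a))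
      where
      k∈ = ∈-range⁺ 1≤k (<⇒≤ (proj₂ (∈-range⁻ k+1∈)))
      -- otherwise the region of (k+1)' would contain the least element of the block of k, which is at most k
      not-last : isLast k ≡ false
      not-last with isLast k in last
      ... | false = refl
      ... | true  with blockOf-∈ k∈
      ...   | B∈ , k∈B =
        contradiction (minimal (block⊆range B∈ (minB∈block B∈)) (Last⇒SameRegion nc k∈ (isLast-true⁻ k∈ last)))
                      (<⇒≱ (s≤s (minB≤ (block-increasing B∈) k∈B)))

    closing-at-1 : ∀ {a} → (a , 1) ∈ Pairs → pos (pt a) < pos (pt' n)
    closing-at-1 {a} p∈ with ∈-Pairs⁻ p∈
    closing-at-1 {zero}  p∈ | a∈ , _ = contradiction (proj₁ (∈-range⁻ a∈)) λ ()
    closing-at-1 {suc a} p∈ | a∈ , _ = pt<pt' (proj₂ (∈-range⁻ a∈))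

-- the local function of chordWord, so that chordWord n C ≡ concatMap (lettersAt C) (range (2 * n)) holds by refl
lettersAt : ChordDiagram → ℕ → Word
lettersAt C x = map (λ _ → U) (filterᵇ (λ a → leftPos a ≡ᵇ x) C)
             ++ map (λ _ → R) (filterᵇ (λ a → rightPos a ≡ᵇ x) C)

lettersAt-single : ∀ (f : A → Arch) xs x (Q : A → Bool) (left : Bool) → countᵇ Q xs ≡ 1 →
  (∀ {p} → p ∈ xs → (leftPos (f p) ≡ᵇ x) ≡ (Q p ∧ left) × (rightPos (f p) ≡ᵇ x) ≡ (Q p ∧ not left)) →
  lettersAt (map f xs) x ≡ (if left then U else R) ∷ []
lettersAt-single f xs x Q left one ends =
  trans (cong₂ _++_ (side U left {leftPos} (proj₁ ∘ ends)) (side R (not left) {rightPos} (proj₂ ∘ ends))) (by-side left)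
  where
  side : ∀ s b {end : Arch → ℕ} → (∀ {p} → p ∈ xs → (end (f p) ≡ᵇ x) ≡ (Q p ∧ b)) →
    map (λ _ → s) (filterᵇ (λ a → end a ≡ᵇ x) (map f xs)) ≡ replicate (if b then 1 else 0) s
  side s b {end} at-x = begin
    map (λ _ → s) (filterᵇ (λ a → end a ≡ᵇ x) (map f xs))  ≡⟨ map-const s _ ⟩
    replicate (countᵇ (λ a → end a ≡ᵇ x) (map f xs)) s     ≡⟨ cong (λ k → replicate k s) count ⟩
    replicate (if b then 1 else 0) s                        ∎
    where
    open ≡-Reasoning
    count : countᵇ (λ a → end a ≡ᵇ x) (map f xs) ≡ (if b then 1 else 0)
    count = begin
      countᵇ (λ a → end a ≡ᵇ x) (map f xs)  ≡⟨ countᵇ-map _ f xs ⟩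
      countᵇ (λ p → end (f p) ≡ᵇ x) xs      ≡⟨ countᵇ-cong xs at-x ⟩
      countᵇ (λ p → Q p ∧ b) xs             ≡⟨ countᵇ-∧ʳ Q b xs ⟩
      (if b then countᵇ Q xs else 0)        ≡⟨ cong (if b then_else 0) one ⟩
      (if b then 1 else 0)                  ∎
  by-side : ∀ b → replicate (if b then 1 else 0) U ++ replicate (if not b then 1 else 0) R ≡ (if b then U else R) ∷ []
  by-side true  = refl
  by-side false = refl

module ChordLetters {n : ℕ} {π : Partition} (isP : IsPartition n π) (nc : NonCrossing π) where
  open PartitionFacts isP
  open RegionPairs isP

  arch : ℕ × ℕ → Arch
  arch (i , j) = pt i , predPrime n j

  diagram : ChordDiagram
  diagram = Ψ n (ρ n π)

  diagram≡arches : diagram ≡ map arch Pairs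
  diagram≡arches = trans (concatMap-cong (λ B → map-cong (λ { (i , j) → refl }) (cyclicPairs B)) (ρ n π))
              (sym (map-concatMap arch cyclicPairs (ρ n π)))

  point-ends : ∀ {i} → i ∈ range n → ∀ {p} → p ∈ Pairs →
    (leftPos (arch p) ≡ᵇ pos (pt i)) ≡ ((proj₁ p ≡ᵇ i) ∧ isFirst i) ×
    (rightPos (arch p) ≡ᵇ pos (pt i)) ≡ ((proj₁ p ≡ᵇ i) ∧ not (isFirst i))
  point-ends {i} i∈ {a , j} p∈ with a ≟ i
  ... | no a≢i rewrite ≡ᵇ-false a≢i =
    no-end (a≢i ∘ pos-pt-injective 1≤a (proj₁ (∈-range⁻ i∈))) (pt≢predPrime (proj₁ (∈-range⁻ i∈)) n j ∘ sym)
    where 1≤a = proj₁ (∈-range⁻ (proj₁ (∈-Pairs⁻ p∈)))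
  ... | yes refl rewrite ≡ᵇ-refl a with point-orientation nc p∈
  ...   | inj₁ (first , u<v)     rewrite first     = min-end u<v
  ...   | inj₂ (not-first , v<u)
    rewrite not-first | ⊓-comm (pos (pt a)) (pos (predPrime n j)) | ⊔-comm (pos (pt a)) (pos (predPrime n j)) = max-end v<u

  prime-ends : ∀ {k} → 1 ≤ k → k < n → ∀ {p} → p ∈ Pairs →
    (leftPos (arch p) ≡ᵇ pos (pt' k)) ≡ ((proj₂ p ≡ᵇ suc k) ∧ not (isLast k)) ×
    (rightPos (arch p) ≡ᵇ pos (pt' k)) ≡ ((proj₂ p ≡ᵇ suc k) ∧ not (not (isLast k)))
  prime-ends {suc k} 1≤k k<n {a , j} p∈ with j ≟ suc (suc k)
  ... | no j≢k+1 rewrite ≡ᵇ-false j≢k+1 = no-end (pt≢pt' 1≤a (suc k)) (predPrime≢ j j∈ j≢k+1)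
    where
    1≤a = proj₁ (∈-range⁻ (proj₁ (∈-Pairs⁻ p∈)))
    j∈ = proj₁ (proj₂ (∈-Pairs⁻ p∈))
    predPrime≢ : ∀ j → j ∈ range n → j ≢ suc (suc k) → pos (predPrime n j) ≢ pos (pt' (suc k))
    predPrime≢ zero          j∈ _   _ = contradiction (proj₁ (∈-range⁻ j∈)) λ ()
    predPrime≢ (suc zero)    _  _   e = <-irrefl (sym (*-cancelˡ-≡ n (suc k) 2 e)) k<n
    predPrime≢ (suc (suc j)) _  j≢ e = j≢ (cong suc (*-cancelˡ-≡ (suc j) (suc k) 2 e))
  ... | yes refl rewrite ≡ᵇ-refl k with prime-orientation nc p∈ 1≤k
  ...   | inj₁ (last , u<v)     rewrite last     = max-end u<v
  ...   | inj₂ (not-last , v<u)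
    rewrite not-last | ⊓-comm (pos (pt a)) (pos (pt' (suc k))) | ⊔-comm (pos (pt a)) (pos (pt' (suc k))) = min-end v<u

  last-prime-ends : ∀ {p} → p ∈ Pairs →
    (leftPos (arch p) ≡ᵇ pos (pt' n)) ≡ ((proj₂ p ≡ᵇ 1) ∧ false) ×
    (rightPos (arch p) ≡ᵇ pos (pt' n)) ≡ ((proj₂ p ≡ᵇ 1) ∧ not false)
  last-prime-ends {a , j} p∈ with j ≟ 1
  ... | no j≢1 rewrite ≡ᵇ-false j≢1 = no-end (pt≢pt' 1≤a n) (predPrime≢ j j∈ j≢1)
    where
    1≤a = proj₁ (∈-range⁻ (proj₁ (∈-Pairs⁻ p∈)))
    j∈ = proj₁ (proj₂ (∈-Pairs⁻ p∈))
    predPrime≢ : ∀ j → j ∈ range n → j ≢ 1 → pos (predPrime n j) ≢ pos (pt' n)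
    predPrime≢ zero          j∈ _   _ = contradiction (proj₁ (∈-range⁻ j∈)) λ ()
    predPrime≢ (suc zero)    _  j≢1 _ = j≢1 refl
    predPrime≢ (suc (suc j)) j∈ _   e = <-irrefl (*-cancelˡ-≡ (suc j) n 2 e) (proj₂ (∈-range⁻ j∈))
  ... | yes refl = max-end (closing-at-1 nc p∈)

  lettersAt-point : ∀ {i} → i ∈ range n → lettersAt diagram (pos (pt i)) ≡ (if isFirst i then U else R) ∷ []
  lettersAt-point {i} i∈ = trans (cong (λ C → lettersAt C (pos (pt i))) diagram≡arches)
    (lettersAt-single arch Pairs _ (λ p → proj₁ p ≡ᵇ i) (isFirst i) (count-first i∈) (point-ends i∈))

  lettersAt-prime : ∀ {k} → k ∈ range n → lettersAt diagram (pos (pt' k)) ≡ (if isLast k then R else U) ∷ []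
  lettersAt-prime {k} k∈ with k <? n
  ... | yes k<n = begin
    lettersAt diagram (pos (pt' k))      ≡⟨ cong (λ C → lettersAt C (pos (pt' k))) diagram≡arches ⟩
    lettersAt (map arch Pairs) (pos (pt' k))
      ≡⟨ lettersAt-single arch Pairs _ (λ p → proj₂ p ≡ᵇ suc k) (not (isLast k))
                          (count-second (∈-range⁺ (s≤s z≤n) k<n)) (prime-ends (proj₁ (∈-range⁻ k∈)) k<n) ⟩
    (if not (isLast k) then U else R) ∷ []  ≡⟨ cong (_∷ []) (if-not (isLast k)) ⟩
    (if isLast k then R else U) ∷ []        ∎
    where open ≡-Reasoning
  ... | no k≮n with ≤-antisym (proj₂ (∈-range⁻ k∈)) (≮⇒≥ k≮n)
  ...   | refl rewrite isLast-true⁺ k∈ (Last-n (proj₁ (∈-range⁻ k∈))) =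
    trans (cong (λ C → lettersAt C (pos (pt' k))) diagram≡arches)
          (lettersAt-single arch Pairs _ (λ p → proj₂ p ≡ᵇ 1) false
                            (count-second (∈-range⁺ ≤-refl (proj₁ (∈-range⁻ k∈)))) last-prime-ends)

  chordWord-letters : chordWord n diagram ≡ concatMap letters (range n)
  chordWord-letters = begin
    concatMap (lettersAt diagram) (range (2 * n))
      ≡⟨ cong (concatMap (lettersAt diagram)) (range-double n) ⟩
    concatMap (lettersAt diagram) (concatMap (λ i → 2 * i ∸ 1 ∷ 2 * i ∷ []) (range n))
      ≡⟨ concatMap-concatMap (lettersAt diagram) _ (range n) ⟩
    concatMap (λ i → lettersAt diagram (2 * i ∸ 1) ++ lettersAt diagram (2 * i) ++ []) (range n)
      ≡⟨ cong concat (map-cong-local (All.tabulate λ {i} i∈ →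
           trans (cong (lettersAt diagram (2 * i ∸ 1) ++_) (++-identityʳ _))
                 (cong₂ _++_ (lettersAt-point i∈) (lettersAt-prime i∈)))) ⟩
    concatMap letters (range n)
      ∎
    where open ≡-Reasoning

mainTheorem7 : (n : ℕ) → 1 ≤ n → (π : Partition) → IsPartition n π → NonCrossing π →
    κ π ≡ chordWord n (Ψ n (ρ n π))
mainTheorem7 n 1≤n π isP nc = begin
  κ π                           ≡⟨ KappaWord.κ-letters isP nc 1≤n ⟩
  concatMap letters (range n)   ≡⟨ ChordLetters.chordWord-letters isP nc ⟨
  chordWord n (Ψ n (ρ n π))     ∎
  where
  open ≡-Reasoning
  open PartitionFacts isP using (letters)
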